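{- Suppose $G$ is a double-arborescence on $n$ vertices with clique number $k$. Then $\ell(G)=2n-k$.
   Context: A treelike comparability graph is a graph admitting a transitive orientation whose Hasse diagram (transitive reduction), as an undirected graph, is a tree. A double-arborescence is a treelike comparability graph $G=(V,E)$ with a vertex $r$ such that $V=\{r\}\cup N_G(r)$. A word over a finite alphabet is a finite sequence of letters. Letters $a,b$ alternate in a word $w$ if the subsequence of $w$ consisting of all occurrences of $a$ and $b$ is of the form $abab\cdots$ or $baba\cdots$ (of even or odd length). A graph $G=(V,E)$ is word-representable if there is a word $w$ over $V$ (a word-representant) such that for all $a,b\in V$, $a$ and $b$ are adjacent iff they alternate in $w$. $\ell(G)$ denotes the minimum length of a word-representant of $G$ (double-arborescences are word-representable). The clique number is the size of a largest complete subgraph. -}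

module Defs where

open import Level using (0ℓ)
open import Data.Nat using (ℕ; zero; suc; _≤_; _*_; _∸_)
open import Data.Fin using (Fin; _≟_)
open import Data.Fin.Subset using (Subset; _∈_; ∣_∣)
open import Data.List using (List; []; _∷_; _++_; [_]; length)
open import Data.List.Membership.Propositional using () renaming (_∈_ to _∈ₗ_)
open import Data.List.Relation.Unary.Linked using (Linked)
open import Data.List.Relation.Unary.Unique.Propositional using (Unique)
open import Data.Product using (Σ; ∃; _×_; _,_)
open import Data.Sum using (_⊎_)
open import Relation.Nullary using (¬_; yes; no)
open import Relation.Binary.PropositionalEquality using (_≡_; _≢_)
open import Function.Bundles using (_⇔_)

record Graph (n : ℕ) : Set₁ where
  field
    Adj    : Fin n → Fin n → Set
    sym    : ∀ {a b} → Adj a b → Adj b a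
    irrefl : ∀ {a} → ¬ Adj a a
open Graph public

data Walk {n : ℕ} (H : Fin n → Fin n → Set) : Fin n → Fin n → Set where
  here : ∀ {a} → Walk H a a
  step : ∀ {a c b} → H a c → Walk H c b → Walk H a b

Connected : ∀ {n} → (Fin n → Fin n → Set) → Set
Connected {n} H = ∀ (a b : Fin n) → Walk H a b

IsCycle : ∀ {n} → (Fin n → Fin n → Set) → Fin n → List (Fin n) → Set
IsCycle H x ys = Unique (x ∷ ys) × (2 ≤ length ys) × Linked H (x ∷ ys ++ [ x ])

Acyclic : ∀ {n} → (Fin n → Fin n → Set) → Set
Acyclic {n} H = ∀ (x : Fin n) (ys : List (Fin n)) → ¬ IsCycle H x ys

IsTree : ∀ {n} → (Fin n → Fin n → Set) → Set
IsTree H = Connected H × Acyclic H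

record StrictPartialOrder (n : ℕ) : Set₁ where
  field
    _<ₚ_    : Fin n → Fin n → Set
    irreflₚ : ∀ {a} → ¬ (a <ₚ a)
    transₚ  : ∀ {a b c} → a <ₚ b → b <ₚ c → a <ₚ c
open StrictPartialOrder public

IsTransitiveOrientation : ∀ {n} → Graph n → StrictPartialOrder n → Set
IsTransitiveOrientation G P = ∀ a b → Adj G a b ⇔ (_<ₚ_ P a b ⊎ _<ₚ_ P b a)

Covers : ∀ {n} → StrictPartialOrder n → Fin n → Fin n → Set
Covers {n} P a b = _<ₚ_ P a b × (∀ (c : Fin n) → ¬ (_<ₚ_ P a c × _<ₚ_ P c b))

HasseUndirected : ∀ {n} → StrictPartialOrder n → Fin n → Fin n → Set
HasseUndirected P a b = Covers P a b ⊎ Covers P b a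

TreelikeComparability : ∀ {n} → Graph n → Set₁
TreelikeComparability {n} G =
  Σ (StrictPartialOrder n) λ P → IsTransitiveOrientation G P × IsTree (HasseUndirected P)

DoubleArborescence : ∀ {n} → Graph n → Set₁
DoubleArborescence {n} G =
  TreelikeComparability G × Σ (Fin n) λ r → ∀ (v : Fin n) → v ≢ r → Adj G r v

restrict : ∀ {n} → Fin n → Fin n → List (Fin n) → List (Fin n)
restrict a b [] = []
restrict a b (x ∷ w) with x ≟ a | x ≟ b
... | yes _ | _     = x ∷ restrict a b w
... | no _  | yes _ = x ∷ restrict a b w
... | no _  | no _  = restrict a b w

altWord : ∀ {n} → Fin n → Fin n → ℕ → List (Fin n)
altWord a b zero    = []
altWord a b (suc m) = a ∷ altWord b a m

Alternate : ∀ {n} → List (Fin n) → Fin n → Fin n → Set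
Alternate w a b = ∃ λ m → restrict a b w ≡ altWord a b m ⊎ restrict a b w ≡ altWord b a m

Represents : ∀ {n} → Graph n → List (Fin n) → Set
Represents {n} G w =
  (∀ (v : Fin n) → v ∈ₗ w) × (∀ (a b : Fin n) → a ≢ b → (Adj G a b ⇔ Alternate w a b))

MinRepLength : ∀ {n} → Graph n → ℕ → Set
MinRepLength G m =
  (∃ λ w → Represents G w × length w ≡ m) × (∀ w → Represents G w → m ≤ length w)

IsClique : ∀ {n} → Graph n → Subset n → Set
IsClique {n} G S = ∀ (a b : Fin n) → a ∈ S → b ∈ S → a ≢ b → Adj G a b

CliqueNumber : ∀ {n} → Graph n → ℕ → Set
CliqueNumber {n} G k =
  (∃ λ S → IsClique G S × ∣ S ∣ ≡ k) × (∀ (S : Subset n) → IsClique G S → ∣ S ∣ ≤ k)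

-- Lower bound: in a word-representant every vertex occurs, and the vertices occurring exactly
-- once pairwise alternate, so they form a clique; hence the word has length at least 2n − k.
-- Upper bound: the Hasse diagram is a tree in which r separates the vertices above r from those
-- below it, and two vertices are adjacent iff they lie on different sides or one lies on the
-- tree path from r to the other. Such a graph is represented by the concatenation of two linear
-- orders which both list the upper vertices in preorder and then the lower ones in postorder,
-- with opposite orders among siblings. A maximum clique S is a chain through r closed under
-- tree paths; ranking S first among siblings, its lower part need only be written in the first
-- list and its upper part only in the second, leaving a representant of length 2n − k.
module Submission where

open import Level using (0ℓ)
open import Defs hiding (irrefl) renaming (sym to Adj-sym)
open import Data.Bool using (Bool; true; false; T)
import Data.Bool.Properties as Bool
open import Data.Empty using (⊥-elim)
open import Data.Fin using (Fin; zero; suc; toℕ; _≟_)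
open import Data.Fin.Induction using (spo-wellFounded; spo-noetherian)
open import Data.Fin.Properties using (toℕ<n; toℕ-injective; any?)
open import Data.Fin.Subset using (Subset; ∣_∣; ⁅_⁆; _∪_; _⊂_)
  renaming (_∈_ to _∈ₛ_; _∉_ to _∉ₛ_)
open import Data.Fin.Subset.Properties
  using (p⊂q⇒∣p∣<∣q∣; p⊆p∪q; q⊆p∪q; x∈p∪q⁻; x∈⁅x⁆; x∈⁅y⁆⇒x≡y) renaming (_∈?_ to _∈ₛ?_)
open import Data.List
  using (List; []; _∷_; _++_; [_]; _∷ʳ_; length; map; filter; filterᵇ; allFin; reverse; reverseAcc)
open import Data.List.Properties
  using (∷-injective; ∷-injectiveˡ; ∷-injectiveʳ; ++-assoc; ++-identityʳ; length-++; map-++; map-injective;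
         ∷ʳ-injectiveˡ; ∷ʳ-injectiveʳ; filter-++; filter-≐; reverse-++; unfold-reverse)
open import Data.List.Membership.Propositional using (_∈_; _∉_)
open import Data.List.Membership.Propositional.Properties
  using (∈-++⁺ˡ; ∈-++⁺ʳ; ∈-++⁻; ∈-∃++; ∈-filter⁺; ∈-allFin)
open import Data.List.Relation.Binary.Lex.Strict using (Lex-<; this; next; halt; <-isStrictTotalOrder)
open import Data.List.Relation.Binary.Permutation.Propositional.Properties using (filter-↭; ↭-length)
open import Data.List.Relation.Binary.Pointwise using (Pointwise; Pointwise-≡⇒≡)
open import Data.List.Relation.Unary.All as All using (All; []; _∷_)
import Data.List.Relation.Unary.All.Properties as AllP
open import Data.List.Relation.Unary.AllPairs as AllPairs using (AllPairs; []; _∷_)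
import Data.List.Relation.Unary.AllPairs.Properties as AllPairsₚ
open import Data.List.Relation.Unary.Any as Any using (Any; here; there)
import Data.List.Relation.Unary.Any.Properties as AnyP
open import Data.List.Relation.Unary.Linked as Linked using (Linked; []; [-]; _∷_)
open import Data.List.Relation.Unary.Linked.Properties using (Linked⇒AllPairs)
open import Data.List.Relation.Unary.Unique.Propositional using (Unique)
import Data.List.Relation.Unary.Unique.Propositional.Properties as Unique
open import Data.Nat using (ℕ; zero; suc; _+_; _*_; _∸_; _<_; _≤_; _≡ᵇ_; z≤n; s≤s)
import Data.Nat.Properties as ℕ
open import Data.Nat.Properties
  using (+-mono-≤; *-suc; m+n∸n≡m; ∸-monoʳ-≤; ≡ᵇ⇒≡; suc-injective; 0≢1+n; module ≤-Reasoning)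
open import Algebra.Properties.CommutativeMonoid.Sum ℕ.+-0-commutativeMonoid
  using (sum; ∑-distrib-+; sum-cong-≗; sum-replicate-zero)
open import Data.Product using (∃; ∃₂; _×_; _,_; proj₁; proj₂)
open import Data.Sum using (_⊎_; inj₁; inj₂; swap; [_,_]′)
open import Data.Vec using (lookup; tabulate; _∷_; [])
open import Data.Vec.Properties using (lookup∘tabulate; []=⇒lookup; lookup⇒[]=)
open import Function.Base using (id; flip; _∘_; case_of_)
open import Function.Bundles using (_⇔_; mk⇔; Equivalence)
open import Function.Construct.Composition using (_⇔-∘_)
open import Induction.WellFounded using (Acc; acc)
open import Relation.Binary
  using (IsStrictTotalOrder; IsStrictPartialOrder; StrictTotalOrder; isStrictTotalOrderᶜ;
         Tri; tri<; tri≈; tri>; DecidableEquality)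
open import Relation.Binary.PropositionalEquality hiding ([_])
open import Relation.Nullary using (¬_; Dec; yes; no; does)
open import Relation.Nullary.Decidable using (_⊎-dec_; _×-dec_; decidable-stable; ¬¬-excluded-middle)

private
  variable
    n : ℕ

-- Counting occurrences

indicator : Bool → ℕ
indicator true  = 1
indicator false = 0

count : Fin n → List (Fin n) → ℕ
count v w = length (filter (_≟ v) w)

count-∷ : ∀ (x v : Fin n) w → count v (x ∷ w) ≡ indicator (does (x ≟ v)) + count v w
count-∷ x v w with x ≟ v
... | yes _ = refl
... | no _  = refl

count-++ : ∀ (v : Fin n) xs ys → count v (xs ++ ys) ≡ count v xs + count v ys
count-++ v xs ys = trans (cong length (filter-++ (_≟ v) xs ys)) (length-++ (filter (_≟ v) xs))

∈⇒1≤count : ∀ {v : Fin n} {w} → v ∈ w → 1 ≤ count v w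
∈⇒1≤count {v = v} {w} v∈w with filter (_≟ v) w | ∈-filter⁺ (_≟ v) v∈w refl
... | _ ∷ _ | _ = s≤s z≤n

1≤count⇒∈ : ∀ {v : Fin n} w → 1 ≤ count v w → v ∈ w
1≤count⇒∈ {v = v} (x ∷ w) c with x ≟ v
... | yes refl = here refl
... | no _     = there (1≤count⇒∈ w c)

∑-indicator-≟ : ∀ (x : Fin n) → sum (λ v → indicator (does (x ≟ v))) ≡ 1
∑-indicator-≟ {suc n} zero    = cong suc (sum-replicate-zero n)
∑-indicator-≟ {suc n} (suc x) = ∑-indicator-≟ x

length≡∑count : ∀ (w : List (Fin n)) → length w ≡ sum (λ v → count v w)
length≡∑count {n} []  = sym (sum-replicate-zero n)
length≡∑count (x ∷ w) = sym (begin
  sum (λ v → count v (x ∷ w))         ≡⟨ sum-cong-≗ (λ v → count-∷ x v w) ⟩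
  sum (λ v → [x≡ v ] + count v w)     ≡⟨ ∑-distrib-+ [x≡_] (λ v → count v w) ⟩
  sum [x≡_] + sum (λ v → count v w)   ≡⟨ cong₂ _+_ (∑-indicator-≟ x) (sym (length≡∑count w)) ⟩
  suc (length w)                      ∎)
  where
  open ≡-Reasoning
  [x≡_] = λ v → indicator (does (x ≟ v))

∑-mono-≤ : ∀ {f g : Fin n → ℕ} → (∀ v → f v ≤ g v) → sum f ≤ sum g
∑-mono-≤ {zero}  f≤g = z≤n
∑-mono-≤ {suc n} f≤g = +-mono-≤ (f≤g zero) (∑-mono-≤ (λ v → f≤g (suc v)))

∑-2∸indicator+∣S∣ : ∀ (S : Subset n) → sum (λ v → 2 ∸ indicator (lookup S v)) + ∣ S ∣ ≡ 2 * n
∑-2∸indicator+∣S∣ []          = refl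
∑-2∸indicator+∣S∣ {suc n} (true ∷ S) =
  trans (cong suc (trans (ℕ.+-suc _ ∣ S ∣) (cong suc (∑-2∸indicator+∣S∣ S)))) (sym (*-suc 2 n))
∑-2∸indicator+∣S∣ {suc n} (false ∷ S) = trans (cong (2 +_) (∑-2∸indicator+∣S∣ S)) (sym (*-suc 2 n))

∑-2∸indicator : ∀ (S : Subset n) → sum (λ v → 2 ∸ indicator (lookup S v)) ≡ 2 * n ∸ ∣ S ∣
∑-2∸indicator S = trans (sym (m+n∸n≡m _ ∣ S ∣)) (cong (_∸ ∣ S ∣) (∑-2∸indicator+∣S∣ S))

count-∉ : ∀ {v : Fin n} {w} → v ∉ w → count v w ≡ 0
count-∉ {w = []} _ = refl
count-∉ {v = v} {x ∷ w} v∉ with x ≟ v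
... | yes refl = ⊥-elim (v∉ (here refl))
... | no _     = count-∉ (λ v∈ → v∉ (there v∈))

count-unique : ∀ {v : Fin n} {w} → Unique w → v ∈ w → count v w ≡ 1
count-unique {v = v} {x ∷ w} (x∉w ∷ unique) v∈ with x ≟ v
... | yes refl = cong suc (count-∉ (λ x∈w → All.lookup x∉w x∈w refl))
... | no x≢v with v∈
...   | here v≡x  = ⊥-elim (x≢v (sym v≡x))
...   | there v∈w = count-unique unique v∈w

count-filterᵇ-accept : ∀ {f : Fin n → Bool} {v} w → f v ≡ true → count v (filterᵇ f w) ≡ count v w
count-filterᵇ-accept [] _ = refl
count-filterᵇ-accept {f = f} {v} (x ∷ w) fv with f x in fx
... | true with x ≟ v
...   | yes _ = cong suc (count-filterᵇ-accept w fv)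
...   | no _  = count-filterᵇ-accept w fv
count-filterᵇ-accept {f = f} {v} (x ∷ w) fv | false with x ≟ v
...   | yes refl with trans (sym fx) fv
...     | ()
count-filterᵇ-accept {f = f} {v} (x ∷ w) fv | false | no _ = count-filterᵇ-accept w fv

count-filterᵇ-reject : ∀ {f : Fin n → Bool} {v} w → f v ≡ false → count v (filterᵇ f w) ≡ 0
count-filterᵇ-reject [] _ = refl
count-filterᵇ-reject {f = f} {v} (x ∷ w) fv with f x in fx
... | false = count-filterᵇ-reject w fv
... | true with x ≟ v
...   | yes refl with trans (sym fv) fx
...     | ()
count-filterᵇ-reject {f = f} {v} (x ∷ w) fv | true | no _ = count-filterᵇ-reject w fv

-- Restriction and alternation

both⇔ : ∀ {P Q : Set} → P → Q → P ⇔ Q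
both⇔ p q = mk⇔ (λ _ → q) (λ _ → p)

neither⇔ : ∀ {P Q : Set} → ¬ P → ¬ Q → P ⇔ Q
neither⇔ ¬p ¬q = mk⇔ (⊥-elim ∘ ¬p) (⊥-elim ∘ ¬q)

restrict≡filter : ∀ (a b : Fin n) w → restrict a b w ≡ filter (λ x → x ≟ a ⊎-dec x ≟ b) w
restrict≡filter a b [] = refl
restrict≡filter a b (x ∷ w) with x ≟ a | x ≟ b
... | yes _ | _     = cong (x ∷_) (restrict≡filter a b w)
... | no _  | yes _ = cong (x ∷_) (restrict≡filter a b w)
... | no _  | no _  = restrict≡filter a b w

restrict-++ : ∀ (a b : Fin n) xs ys → restrict a b (xs ++ ys) ≡ restrict a b xs ++ restrict a b ys
restrict-++ a b xs ys = begin
  restrict a b (xs ++ ys)     ≡⟨ restrict≡filter a b (xs ++ ys) ⟩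
  filter _ (xs ++ ys)         ≡⟨ filter-++ _ xs ys ⟩
  filter _ xs ++ filter _ ys  ≡⟨ sym (cong₂ _++_ (restrict≡filter a b xs) (restrict≡filter a b ys)) ⟩
  restrict a b xs ++ restrict a b ys ∎
  where open ≡-Reasoning

restrict-comm : ∀ (a b : Fin n) w → restrict a b w ≡ restrict b a w
restrict-comm a b w = begin
  restrict a b w ≡⟨ restrict≡filter a b w ⟩
  filter _ w     ≡⟨ filter-≐ _ _ (swap , swap) w ⟩
  filter _ w     ≡⟨ sym (restrict≡filter b a w) ⟩
  restrict b a w ∎
  where open ≡-Reasoning

Alternate-sym : ∀ w {a b : Fin n} → Alternate w a b → Alternate w b a
Alternate-sym w {a} {b} (m , inj₁ e) = m , inj₂ (trans (restrict-comm b a w) e)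
Alternate-sym w {a} {b} (m , inj₂ e) = m , inj₁ (trans (restrict-comm b a w) e)

altWord-≢-repeat : ∀ {a b : Fin n} m xs {x} ys → a ≢ b → altWord a b m ≢ xs ++ x ∷ x ∷ ys
altWord-≢-repeat (suc (suc m)) []       ys a≢b refl = a≢b refl
altWord-≢-repeat (suc m)       (_ ∷ xs) ys a≢b e    =
  altWord-≢-repeat m xs ys (≢-sym a≢b) (∷-injectiveʳ e)

¬Alternate-repeat : ∀ w {a b : Fin n} xs {x} ys → a ≢ b →
                    restrict a b w ≡ xs ++ x ∷ x ∷ ys → ¬ Alternate w a b
¬Alternate-repeat w xs ys a≢b e (m , inj₁ e′) = altWord-≢-repeat m xs ys a≢b (trans (sym e′) e)
¬Alternate-repeat w xs ys a≢b e (m , inj₂ e′) =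
  altWord-≢-repeat m xs ys (≢-sym a≢b) (trans (sym e′) e)

restrict-absent : ∀ {a b : Fin n} w → count a w ≡ 0 → count b w ≡ 0 → restrict a b w ≡ []
restrict-absent []          _  _  = refl
restrict-absent {a = a} {b} (x ∷ w) ca cb with x ≟ a | x ≟ b
... | yes _ | _     = ⊥-elim (0≢1+n (sym ca))
... | no _  | yes _ = ⊥-elim (0≢1+n (sym cb))
... | no _  | no _  = restrict-absent w ca cb

restrict-single : ∀ {a b : Fin n} w → count a w ≡ 1 → count b w ≡ 0 → restrict a b w ≡ a ∷ []
restrict-single {a = a} {b} (x ∷ w) ca cb with x ≟ a | x ≟ b
... | _        | yes _ = ⊥-elim (0≢1+n (sym cb))
... | yes refl | no _  = cong (x ∷_) (restrict-absent w (suc-injective ca) cb)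
... | no _     | no _  = restrict-single w ca cb

restrict-pair : ∀ {a b : Fin n} w → a ≢ b → count a w ≡ 1 → count b w ≡ 1 →
                restrict a b w ≡ a ∷ b ∷ [] ⊎ restrict a b w ≡ b ∷ a ∷ []
restrict-pair {a = a} {b} (x ∷ w) a≢b ca cb with x ≟ a | x ≟ b
... | yes refl | yes refl = ⊥-elim (a≢b refl)
... | yes refl | no _     =
  inj₁ (cong (x ∷_) (trans (restrict-comm a b w) (restrict-single w cb (suc-injective ca))))
... | no _     | yes refl = inj₂ (cong (x ∷_) (restrict-single w ca (suc-injective cb)))
... | no _     | no _     = restrict-pair w a≢b ca cb

Alternate-once : ∀ w {a b : Fin n} → a ≢ b → count a w ≡ 1 → count b w ≡ 1 → Alternate w a b
Alternate-once w a≢b ca cb with restrict-pair w a≢b ca cb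
... | inj₁ e = 2 , inj₁ e
... | inj₂ e = 2 , inj₂ e

restrict-sorted : ∀ {R : Fin n → Fin n → Set} {a b : Fin n} {w} → AllPairs R w → a ≢ b → ¬ R b a →
                  count a w ≡ 1 → count b w ≡ 1 → restrict a b w ≡ a ∷ b ∷ []
restrict-sorted {a = a} {b} {w} sorted a≢b ¬Rba ca cb with restrict-pair w a≢b ca cb
... | inj₁ e = e
... | inj₂ e with subst (AllPairs _) (trans (sym (restrict≡filter a b w)) e) (AllPairsₚ.filter⁺ _ sorted)
...   | (Rba ∷ []) ∷ _ = ⊥-elim (¬Rba Rba)

-- The lower bound

singletons : List (Fin n) → Subset n
singletons w = tabulate (λ v → count v w ≡ᵇ 1)

∈-singletons⁻ : ∀ w {v : Fin n} → v ∈ₛ singletons w → count v w ≡ 1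
∈-singletons⁻ w {v} v∈ =
  ≡ᵇ⇒≡ (count v w) 1 (subst T (sym (trans (sym (lookup∘tabulate _ v)) ([]=⇒lookup v∈))) _)

singletons-clique : ∀ (G : Graph n) {w} → Represents G w → IsClique G (singletons w)
singletons-clique G {w} (_ , adj⇔alt) a b a∈ b∈ a≢b =
  Equivalence.from (adj⇔alt a b a≢b) (Alternate-once w a≢b (∈-singletons⁻ w a∈) (∈-singletons⁻ w b∈))

2∸[≡1]≤ : ∀ c → 1 ≤ c → 2 ∸ indicator (c ≡ᵇ 1) ≤ c
2∸[≡1]≤ (suc zero)    _ = s≤s z≤n
2∸[≡1]≤ (suc (suc c)) _ = s≤s (s≤s z≤n)

representant-length-≥ : ∀ (G : Graph n) k → (∀ S → IsClique G S → ∣ S ∣ ≤ k) →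
                        ∀ w → Represents G w → 2 * n ∸ k ≤ length w
representant-length-≥ {n} G k maximal w rep@(all∈ , _) = begin
  2 * n ∸ k                               ≤⟨ ∸-monoʳ-≤ (2 * n) (maximal O (singletons-clique G rep)) ⟩
  2 * n ∸ ∣ O ∣                           ≡⟨ sym (∑-2∸indicator O) ⟩
  sum (λ v → 2 ∸ indicator (lookup O v))  ≤⟨ ∑-mono-≤ pointwise ⟩
  sum (λ v → count v w)                   ≡⟨ sym (length≡∑count w) ⟩
  length w                                ∎
  where
  open ≤-Reasoning
  O = singletons w
  pointwise : ∀ v → 2 ∸ indicator (lookup O v) ≤ count v w
  pointwise v rewrite lookup∘tabulate (λ v → count v w ≡ᵇ 1) v =
    2∸[≡1]≤ (count v w) (∈⇒1≤count (all∈ v))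

-- Words built from two linear orders

module Enumeration {_<_ : Fin n → Fin n → Set} (sto : IsStrictTotalOrder _≡_ _<_) where

  private
    strictTotalOrder : StrictTotalOrder 0ℓ 0ℓ 0ℓ
    strictTotalOrder = record { isStrictTotalOrder = sto }
    open IsStrictTotalOrder sto using (compare; asym; irrefl)
    open import Relation.Binary.Properties.StrictTotalOrder strictTotalOrder
      using (decTotalOrder) renaming (_≤_ to _≼_; trans to ≼-trans)
    open import Data.List.Sort decTotalOrder using (sort; sort-↭; sort-↗)

  enumeration : List (Fin n)
  enumeration = sort (allFin n)

  count-enumeration : ∀ v → count v enumeration ≡ 1
  count-enumeration v = trans (↭-length (filter-↭ (_≟ v) (sort-↭ (allFin n))))
                              (count-unique (Unique.allFin⁺ n) (∈-allFin v))

  enumeration-sorted : AllPairs _≼_ enumeration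
  enumeration-sorted = Linked⇒AllPairs ≼-trans (sort-↗ (allFin n))

  module _ (f : Fin n → Bool) where

    count-filterᵇ-enumeration : ∀ {v} → f v ≡ true → count v (filterᵇ f enumeration) ≡ 1
    count-filterᵇ-enumeration {v} fv = trans (count-filterᵇ-accept enumeration fv) (count-enumeration v)

    restrict-filterᵇ-enumeration : ∀ {a b} → f a ≡ true → f b ≡ true → a < b →
                                   restrict a b (filterᵇ f enumeration) ≡ a ∷ b ∷ []
    restrict-filterᵇ-enumeration fa fb a<b =
      restrict-sorted (AllPairsₚ.filter⁺ _ enumeration-sorted) (λ { refl → irrefl refl a<b })
        (λ { (inj₁ b<a) → asym a<b b<a ; (inj₂ refl) → irrefl refl a<b })
        (count-filterᵇ-enumeration fa) (count-filterᵇ-enumeration fb)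

    restrict-filterᵇ-enumeration-right : ∀ {a b} → f a ≡ false → f b ≡ true →
                                         restrict a b (filterᵇ f enumeration) ≡ b ∷ []
    restrict-filterᵇ-enumeration-right {a} {b} fa fb = trans (restrict-comm a b (filterᵇ f enumeration))
      (restrict-single (filterᵇ f enumeration) (count-filterᵇ-enumeration fb)
                       (count-filterᵇ-reject enumeration fa))

data Placement : Set where
  early late twice : Placement

inFirst : Placement → Bool
inFirst late = false
inFirst _    = true

inSecond : Placement → Bool
inSecond early = false
inSecond _     = true

multiplicity : Placement → ℕ
multiplicity twice = 2
multiplicity _     = 1

-- A pair written twice alternates iff both halves order it alike; an early a and a twice b
-- alternate iff b comes first in the first half (b a b), a late a and a twice b iff a comes
-- first in the second half (b a b).
module TwoOrderWord
  (_~_ : Fin n → Fin n → Set) (~-sym : ∀ {a b} → a ~ b → b ~ a)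
  {_<₁_ _<₂_ : Fin n → Fin n → Set}
  (sto₁ : IsStrictTotalOrder _≡_ _<₁_) (sto₂ : IsStrictTotalOrder _≡_ _<₂_)
  (place : Fin n → Placement)
  (once-once   : ∀ {a b} → a ≢ b → place a ≢ twice → place b ≢ twice → a ~ b)
  (early-twice : ∀ {a b} → place a ≡ early → place b ≡ twice → a ~ b ⇔ b <₁ a)
  (late-twice  : ∀ {a b} → place a ≡ late → place b ≡ twice → a ~ b ⇔ a <₂ b)
  (twice-twice : ∀ {a b} → place a ≡ twice → place b ≡ twice → a <₁ b → a ~ b ⇔ a <₂ b)
  where

  private
    module E₁ = Enumeration sto₁
    module E₂ = Enumeration sto₂
    module O₁ = IsStrictTotalOrder sto₁
    module O₂ = IsStrictTotalOrder sto₂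

  firstHalf secondHalf word : List (Fin n)
  firstHalf  = filterᵇ (inFirst ∘ place) E₁.enumeration
  secondHalf = filterᵇ (inSecond ∘ place) E₂.enumeration
  word       = firstHalf ++ secondHalf

  count-word : ∀ v → count v word ≡ multiplicity (place v)
  count-word v = trans (count-++ v firstHalf secondHalf) (by-placement (place v) refl)
    where
    by-placement : ∀ p → place v ≡ p → count v firstHalf + count v secondHalf ≡ multiplicity p
    by-placement early e = cong₂ _+_ (E₁.count-filterᵇ-enumeration _ (cong inFirst e))
                               (count-filterᵇ-reject E₂.enumeration (cong inSecond e))
    by-placement late  e = cong₂ _+_ (count-filterᵇ-reject E₁.enumeration (cong inFirst e))
                               (E₂.count-filterᵇ-enumeration _ (cong inSecond e))
    by-placement twice e = cong₂ _+_ (E₁.count-filterᵇ-enumeration _ (cong inFirst e))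
                               (E₂.count-filterᵇ-enumeration _ (cong inSecond e))

  private
    halves : ∀ {a b xs ys} → restrict a b firstHalf ≡ xs → restrict a b secondHalf ≡ ys →
             restrict a b word ≡ xs ++ ys
    halves {a} {b} e₁ e₂ = trans (restrict-++ a b firstHalf secondHalf) (cong₂ _++_ e₁ e₂)

    sorted₁ : ∀ {a b} → inFirst (place a) ≡ true → inFirst (place b) ≡ true → a <₁ b →
              restrict a b firstHalf ≡ a ∷ b ∷ []
    sorted₁ = E₁.restrict-filterᵇ-enumeration _

    sorted₂ : ∀ {a b} → inSecond (place a) ≡ true → inSecond (place b) ≡ true → a <₂ b →
              restrict a b secondHalf ≡ a ∷ b ∷ []
    sorted₂ = E₂.restrict-filterᵇ-enumeration _

    sorted₁′ : ∀ {a b} → inFirst (place a) ≡ true → inFirst (place b) ≡ true → b <₁ a →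
               restrict a b firstHalf ≡ b ∷ a ∷ []
    sorted₁′ {a} {b} fa fb b<a = trans (restrict-comm a b firstHalf) (sorted₁ fb fa b<a)

    sorted₂′ : ∀ {a b} → inSecond (place a) ≡ true → inSecond (place b) ≡ true → b <₂ a →
               restrict a b secondHalf ≡ b ∷ a ∷ []
    sorted₂′ {a} {b} fa fb b<a = trans (restrict-comm a b secondHalf) (sorted₂ fb fa b<a)

    count-once : ∀ {v} → place v ≢ twice → count v word ≡ 1
    count-once {v} p≢twice with place v | count-word v
    ... | early | c = c
    ... | late  | c = c
    ... | twice | _ = ⊥-elim (p≢twice refl)

    placed : ∀ {v p} → place v ≡ p → p ≢ twice → place v ≢ twice
    placed pv p≢twice e = p≢twice (trans (sym pv) e)

    swapped : ∀ {a b} → b ~ a ⇔ Alternate word b a → a ~ b ⇔ Alternate word a b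
    swapped b~a⇔alt = mk⇔ (Alternate-sym word ∘ Equivalence.to b~a⇔alt ∘ ~-sym)
                          (~-sym ∘ Equivalence.from b~a⇔alt ∘ Alternate-sym word)

  once-alternation : ∀ {a b} → a ≢ b → place a ≢ twice → place b ≢ twice → a ~ b ⇔ Alternate word a b
  once-alternation a≢b pa pb =
    both⇔ (once-once a≢b pa pb) (Alternate-once word a≢b (count-once pa) (count-once pb))

  early-twice-alternation : ∀ {a b} → a ≢ b → place a ≡ early → place b ≡ twice →
                            b <₁ a ⇔ Alternate word a b
  early-twice-alternation {a} {b} a≢b pa pb with O₁.compare a b
  ... | tri< a<b _ ¬b<a = neither⇔ ¬b<a
    (¬Alternate-repeat word (a ∷ []) [] a≢b
      (halves (sorted₁ (cong inFirst pa) (cong inFirst pb) a<b) only-b₂))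
    where only-b₂ = E₂.restrict-filterᵇ-enumeration-right _ (cong inSecond pa) (cong inSecond pb)
  ... | tri≈ _ a≡b _ = ⊥-elim (a≢b a≡b)
  ... | tri> _ _ b<a = both⇔ b<a
    (3 , inj₂ (halves (sorted₁′ (cong inFirst pa) (cong inFirst pb) b<a) only-b₂))
    where only-b₂ = E₂.restrict-filterᵇ-enumeration-right _ (cong inSecond pa) (cong inSecond pb)

  late-twice-alternation : ∀ {a b} → a ≢ b → place a ≡ late → place b ≡ twice →
                           a <₂ b ⇔ Alternate word a b
  late-twice-alternation {a} {b} a≢b pa pb with O₂.compare a b
  ... | tri< a<b _ _ = both⇔ a<b
    (3 , inj₂ (halves only-b₁ (sorted₂ (cong inSecond pa) (cong inSecond pb) a<b)))
    where only-b₁ = E₁.restrict-filterᵇ-enumeration-right _ (cong inFirst pa) (cong inFirst pb)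
  ... | tri≈ _ a≡b _ = ⊥-elim (a≢b a≡b)
  ... | tri> ¬a<b _ b<a = neither⇔ ¬a<b
    (¬Alternate-repeat word [] (a ∷ []) a≢b
      (halves only-b₁ (sorted₂′ (cong inSecond pa) (cong inSecond pb) b<a)))
    where only-b₁ = E₁.restrict-filterᵇ-enumeration-right _ (cong inFirst pa) (cong inFirst pb)

  twice-twice-alternation : ∀ {a b} → a ≢ b → place a ≡ twice → place b ≡ twice → a <₁ b →
                            a <₂ b ⇔ Alternate word a b
  twice-twice-alternation {a} {b} a≢b pa pb a<₁b with O₂.compare a b
  ... | tri< a<b _ _ = both⇔ a<b
    (4 , inj₁ (halves (sorted₁ (cong inFirst pa) (cong inFirst pb) a<₁b)
                      (sorted₂ (cong inSecond pa) (cong inSecond pb) a<b)))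
  ... | tri≈ _ a≡b _ = ⊥-elim (a≢b a≡b)
  ... | tri> ¬a<b _ b<a = neither⇔ ¬a<b
    (¬Alternate-repeat word (a ∷ []) (a ∷ []) a≢b
      (halves (sorted₁ (cong inFirst pa) (cong inFirst pb) a<₁b)
              (sorted₂′ (cong inSecond pa) (cong inSecond pb) b<a)))

  word-alternation : ∀ {a b} → a ≢ b → a ~ b ⇔ Alternate word a b
  word-alternation {a} {b} a≢b with place a in pa | place b in pb
  ... | early | twice = early-twice-alternation a≢b pa pb ⇔-∘ early-twice pa pb
  ... | twice | early = swapped (early-twice-alternation (≢-sym a≢b) pb pa ⇔-∘ early-twice pb pa)
  ... | late  | twice = late-twice-alternation a≢b pa pb ⇔-∘ late-twice pa pb
  ... | twice | late  = swapped (late-twice-alternation (≢-sym a≢b) pb pa ⇔-∘ late-twice pb pa)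
  ... | twice | twice with O₁.compare a b
  ...   | tri< a<b _ _ = twice-twice-alternation a≢b pa pb a<b ⇔-∘ twice-twice pa pb a<b
  ...   | tri≈ _ a≡b _ = ⊥-elim (a≢b a≡b)
  ...   | tri> _ _ b<a = swapped (twice-twice-alternation (≢-sym a≢b) pb pa b<a ⇔-∘ twice-twice pb pa b<a)
  word-alternation a≢b | early | early = once-alternation a≢b (placed pa λ ()) (placed pb λ ())
  word-alternation a≢b | early | late  = once-alternation a≢b (placed pa λ ()) (placed pb λ ())
  word-alternation a≢b | late  | early = once-alternation a≢b (placed pa λ ()) (placed pb λ ())
  word-alternation a≢b | late  | late  = once-alternation a≢b (placed pa λ ()) (placed pb λ ())

1≤multiplicity : ∀ p → 1 ≤ multiplicity p
1≤multiplicity early = s≤s z≤n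
1≤multiplicity late  = s≤s z≤n
1≤multiplicity twice = s≤s z≤n

-- Lexicographic keys and forking lists

injective⇒isStrictTotalOrder : ∀ {A B : Set} {_≈_ _<_ : B → B → Set} → IsStrictTotalOrder _≈_ _<_ →
                               (f : A → B) → (∀ {x y} → f x ≈ f y → x ≡ y) →
                               IsStrictTotalOrder _≡_ (λ x y → f x < f y)
injective⇒isStrictTotalOrder {_≈_ = _≈_} {_<_} sto f f-injective = isStrictTotalOrderᶜ record
  { isEquivalence = isEquivalence
  ; trans         = <-trans
  ; compare       = λ x y → pullback (compare (f x) (f y))
  }
  where
  open IsStrictTotalOrder sto using (compare; module Eq) renaming (trans to <-trans)
  open Eq using (reflexive)
  pullback : ∀ {x y} → Tri (f x < f y) (f x ≈ f y) (f y < f x) → Tri (f x < f y) (x ≡ y) (f y < f x)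
  pullback (tri< lt ¬eq ¬gt) = tri< lt (λ { refl → ¬eq (reflexive refl) }) ¬gt
  pullback (tri≈ ¬lt eq ¬gt) = tri≈ ¬lt (f-injective eq) ¬gt
  pullback (tri> ¬lt ¬eq gt) = tri> ¬lt (λ { refl → ¬eq (reflexive refl) }) gt

infix 4 _≺_

_≺_ : List ℕ → List ℕ → Set
_≺_ = Lex-< _≡_ _<_

≺-isStrictTotalOrder : IsStrictTotalOrder (Pointwise _≡_) _≺_
≺-isStrictTotalOrder = <-isStrictTotalOrder ℕ.<-isStrictTotalOrder

≺-++ˡ : ∀ zs {xs ys} → xs ≺ ys → zs ++ xs ≺ zs ++ ys
≺-++ˡ []       xs≺ys = xs≺ys
≺-++ˡ (z ∷ zs) xs≺ys = next refl (≺-++ˡ zs xs≺ys)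

record Fork {A : Set} (xs ys : List A) : Set where
  constructor fork
  field
    stem           : List A
    {left right}   : A
    {rest₁ rest₂}  : List A
    left≢right     : left ≢ right
    xs≡            : xs ≡ stem ++ left ∷ rest₁
    ys≡            : ys ≡ stem ++ right ∷ rest₂

module _ {A : Set} (_≟_ : DecidableEquality A) where

  fork? : ∀ (xs ys : List A) → (∀ t → ys ≢ xs ++ t) → (∀ t → xs ≢ ys ++ t) → Fork xs ys
  fork? []       ys       xs⋢ys _     = ⊥-elim (xs⋢ys ys refl)
  fork? (x ∷ xs) []       _     ys⋢xs = ⊥-elim (ys⋢xs (x ∷ xs) refl)
  fork? (x ∷ xs) (y ∷ ys) xs⋢ys ys⋢xs with x ≟ y
  ... | no x≢y = fork [] x≢y refl refl
  ... | yes refl with fork? xs ys (λ t e → xs⋢ys t (cong (x ∷_) e)) (λ t e → ys⋢xs t (cong (x ∷_) e))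
  ...   | fork c l≢r refl refl = fork (x ∷ c) l≢r refl refl

prefixes-comparable : ∀ {A : Set} (xs ys : List A) {t u} → xs ++ t ≡ ys ++ u →
                      (∃ λ v → ys ≡ xs ++ v) ⊎ (∃ λ v → xs ≡ ys ++ v)
prefixes-comparable []       ys       _ = inj₁ (ys , refl)
prefixes-comparable (x ∷ xs) []       _ = inj₂ (x ∷ xs , refl)
prefixes-comparable (x ∷ xs) (y ∷ ys) e with ∷-injective e
... | refl , e′ with prefixes-comparable xs ys e′
...   | inj₁ (v , refl) = inj₁ (v , refl)
...   | inj₂ (v , refl) = inj₂ (v , refl)

unique-split : ∀ {A : Set} (xs us : List A) {x : A} {ys vs} → Unique (xs ++ x ∷ ys) →
               xs ++ x ∷ ys ≡ us ++ x ∷ vs → xs ≡ us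
unique-split [] [] _ _ = refl
unique-split [] (u ∷ us) {x} (x∉ ∷ _) e with ∷-injective e
... | refl , e′ = ⊥-elim (All.lookup x∉ (subst (x ∈_) (sym e′) (∈-++⁺ʳ us (here refl))) refl)
unique-split (x′ ∷ xs) [] {x} (x∉ ∷ _) e with ∷-injective e
... | refl , _ = ⊥-elim (All.lookup x∉ (∈-++⁺ʳ xs (here refl)) refl)
unique-split (x′ ∷ xs) (u ∷ us) (_ ∷ unique) e with ∷-injective e
... | refl , e′ = cong (x′ ∷_) (unique-split xs us unique e′)

unique-∉-prefix : ∀ {A : Set} (xs : List A) {x : A} {ys} → Unique (xs ++ x ∷ ys) → x ∉ xs
unique-∉-prefix (x′ ∷ xs) (x∉ ∷ _)      (here refl) = All.lookup x∉ (∈-++⁺ʳ xs (here refl)) refl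
unique-∉-prefix (x′ ∷ xs) (_ ∷ unique) (there x∈) = unique-∉-prefix xs unique x∈

-- Double trees

data Side : Set where
  down up : Side

_≟ˢ_ : (s t : Side) → Dec (s ≡ t)
down ≟ˢ down = yes refl
down ≟ˢ up   = no λ ()
up   ≟ˢ down = no λ ()
up   ≟ˢ up   = yes refl

≺-extension : ∀ xs {y ys} → xs ≺ xs ++ y ∷ ys
≺-extension []       = halt
≺-extension (x ∷ xs) = next refl (≺-extension xs)

-- The closing symbol top exceeds every rank, so a down vertex comes after its descendants
-- (postorder), while an up vertex precedes them (preorder).
module Keys {n : ℕ} (ρ : Fin n → ℕ) (top : ℕ) where

  keyOf : Side → List (Fin n) → List ℕ
  keyOf up   xs = 0 ∷ map ρ xs
  keyOf down xs = 1 ∷ map ρ xs ++ [ top ]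

  keyOf-injective : ∀ {s t xs ys} → (∀ {x y} → ρ x ≡ ρ y → x ≡ y) →
                    keyOf s xs ≡ keyOf t ys → xs ≡ ys
  keyOf-injective {up}   {up}   ρ-injective e = map-injective ρ-injective (∷-injectiveʳ e)
  keyOf-injective {down} {down} ρ-injective e = map-injective ρ-injective (∷ʳ-injectiveˡ _ _ (∷-injectiveʳ e))
  keyOf-injective {up}   {down} _ ()
  keyOf-injective {down} {up}   _ ()

  keyOf-up-down : ∀ xs ys → keyOf up xs ≺ keyOf down ys
  keyOf-up-down xs ys = this (s≤s z≤n)

  keyOf-extension-up : ∀ xs {y} ys → keyOf up xs ≺ keyOf up (xs ++ y ∷ ys)
  keyOf-extension-up xs {y} ys rewrite map-++ ρ xs (y ∷ ys) = next refl (≺-extension (map ρ xs))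

  keyOf-extension-down : ∀ xs {y} ys → ρ y < top → keyOf down (xs ++ y ∷ ys) ≺ keyOf down xs
  keyOf-extension-down xs {y} ys ρy<top
    rewrite map-++ ρ xs (y ∷ ys) | ++-assoc (map ρ xs) (ρ y ∷ map ρ ys) [ top ] =
    next refl (≺-++ˡ (map ρ xs) (this ρy<top))

  keyOf-fork : ∀ s c {x y} xs ys → ρ x < ρ y → keyOf s (c ++ x ∷ xs) ≺ keyOf s (c ++ y ∷ ys)
  keyOf-fork up c {x} {y} xs ys ρx<ρy
    rewrite map-++ ρ c (x ∷ xs) | map-++ ρ c (y ∷ ys) = next refl (≺-++ˡ (map ρ c) (this ρx<ρy))
  keyOf-fork down c {x} {y} xs ys ρx<ρy
    rewrite map-++ ρ c (x ∷ xs) | map-++ ρ c (y ∷ ys)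
          | ++-assoc (map ρ c) (ρ x ∷ map ρ xs) [ top ] | ++-assoc (map ρ c) (ρ y ∷ map ρ ys) [ top ] =
    next refl (≺-++ˡ (map ρ c) (this ρx<ρy))

module DoubleTree {n : ℕ} (r : Fin n) (side : Fin n → Side) (path : Fin n → List (Fin n))
  (root-down      : side r ≡ down)
  (path-from-root : ∀ a → ∃ λ t → path a ≡ r ∷ t)
  (path-to        : ∀ a → ∃ λ q → path a ≡ q ∷ʳ a)
  (path-unique    : ∀ a → Unique (path a))
  (path-prefix    : ∀ {a b} → b ∈ path a → ∃ λ t → path a ≡ path b ++ t)
  (path-side      : ∀ {a x} → x ∈ path a → x ≡ r ⊎ side x ≡ side a)
  where

  open import Data.List.Membership.DecPropositional (_≟_ {n}) using (_∈?_)

  Comparable : Fin n → Fin n → Set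
  Comparable a b = side a ≢ side b ⊎ a ∈ path b ⊎ b ∈ path a

  comparable-sym : ∀ {a b} → Comparable a b → Comparable b a
  comparable-sym (inj₁ a≁b)       = inj₁ (≢-sym a≁b)
  comparable-sym (inj₂ (inj₁ a∈)) = inj₂ (inj₂ a∈)
  comparable-sym (inj₂ (inj₂ b∈)) = inj₂ (inj₁ b∈)

  root∈path : ∀ a → r ∈ path a
  root∈path a with path-from-root a
  ... | t , e = subst (r ∈_) (sym e) (here refl)

  ∈-path : ∀ a → a ∈ path a
  ∈-path a with path-to a
  ... | q , e = subst (a ∈_) (sym e) (∈-++⁺ʳ q (here refl))

  path-injective : ∀ {a b} → path a ≡ path b → a ≡ b
  path-injective {a} {b} e with path-to a | path-to b
  ... | qa , ea | qb , eb = ∷ʳ-injectiveʳ qa qb (trans (sym ea) (trans e eb))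

  path-trans : ∀ {a b x} → b ∈ path a → x ∈ path b → x ∈ path a
  path-trans {a} {b} b∈ x∈ with path-prefix b∈
  ... | t , e = subst (_ ∈_) (sym e) (∈-++⁺ˡ x∈)

  proper-prefix : ∀ {a b} → a ∈ path b → a ≢ b → ∃₂ λ y t → path b ≡ path a ++ y ∷ t
  proper-prefix a∈ a≢b with path-prefix a∈
  ... | y ∷ t , e = y , t , e
  ... | []    , e = ⊥-elim (a≢b (path-injective (sym (trans e (++-identityʳ _)))))

  path-through : ∀ {a x} c {s} → path a ≡ c ++ x ∷ s → path x ≡ c ∷ʳ x
  path-through {a} {x} c {s} e with path-prefix (subst (x ∈_) (sym e) (∈-++⁺ʳ c (here refl))) | path-to x
  ... | t , ea | q , ex = trans ex (cong (_∷ʳ x) (sym c≡q))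
    where
    c≡q : c ≡ q
    c≡q = unique-split c q (subst Unique e (path-unique a))
            (trans (sym e) (trans ea (trans (cong (_++ t) ex) (++-assoc q [ x ] t))))

  on-path-comparable : ∀ {a x y} → x ∈ path a → y ∈ path a → x ∈ path y ⊎ y ∈ path x
  on-path-comparable {a} {x} {y} x∈ y∈ with path-prefix x∈ | path-prefix y∈
  ... | t , ex | u , ey with prefixes-comparable (path x) (path y) (trans (sym ex) ey)
  ...   | inj₁ (v , e) = inj₁ (subst (x ∈_) (sym e) (∈-++⁺ˡ (∈-path x)))
  ...   | inj₂ (v , e) = inj₂ (subst (y ∈_) (sym e) (∈-++⁺ˡ (∈-path y)))

  fork-sym : ∀ {xs ys : List (Fin n)} → Fork xs ys → Fork ys xs
  fork-sym (fork c l≢r xs≡ ys≡) = fork c (≢-sym l≢r) ys≡ xs≡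

  module _ {a b} (F : Fork (path a) (path b)) where
    open Fork F

    left∈path : left ∈ path a
    left∈path = subst (left ∈_) (sym xs≡) (∈-++⁺ʳ stem (here refl))

    left≢root : left ≢ r
    left≢root l≡r with path-from-root a | path-from-root b
    ... | t , ea | u , eb = left≢right (trans l≡r (sym right≡r))
      where
      stem≡[] : stem ≡ []
      stem≡[] = unique-split stem [] (subst Unique xs≡ (path-unique a))
                  (trans (sym xs≡) (trans ea (cong (_∷ t) (sym l≡r))))
      right≡r : right ≡ r
      right≡r = ∷-injectiveˡ (trans (sym (subst (λ c → path b ≡ c ++ right ∷ rest₂) stem≡[] ys≡)) eb)

  data Position (a b : Fin n) : Set where
    ancestor   : a ∈ path b → Position a b
    descendant : b ∈ path a → Position a b
    opposite   : side a ≢ side b → Position a b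
    branching  : side a ≡ side b → a ∉ path b → b ∉ path a → Fork (path a) (path b) → Position a b

  position : ∀ a b → Position a b
  position a b with a ∈? path b | b ∈? path a | side a ≟ˢ side b
  ... | yes a∈ | _      | _      = ancestor a∈
  ... | no _   | yes b∈ | _      = descendant b∈
  ... | no _   | no _   | no a≁b = opposite a≁b
  ... | no a∉  | no b∉  | yes a∼b = branching a∼b a∉ b∉
    (fork? _≟_ (path a) (path b) (λ t e → a∉ (prefix-∈ a e)) (λ t e → b∉ (prefix-∈ b e)))
    where
    prefix-∈ : ∀ x {xs t} → xs ≡ path x ++ t → x ∈ xs
    prefix-∈ x e = subst (x ∈_) (sym e) (∈-++⁺ˡ (∈-path x))

  branching-incomparable : ∀ {a b} → side a ≡ side b → a ∉ path b → b ∉ path a → ¬ Comparable a b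
  branching-incomparable a∼b _  _  (inj₁ a≁b)       = a≁b a∼b
  branching-incomparable _   a∉ _  (inj₂ (inj₁ a∈)) = a∉ a∈
  branching-incomparable _   _  b∉ (inj₂ (inj₂ b∈)) = b∉ b∈

  fork-incomparable : ∀ {a b} → side a ≡ side b → (F : Fork (path a) (path b)) →
                      ¬ Comparable (Fork.left F) (Fork.right F)
  fork-incomparable {a} {b} a∼b F@(fork stem l≢r xs≡ ys≡) =
    branching-incomparable l∼r (∉-sibling l≢r xs≡ ys≡) (∉-sibling (≢-sym l≢r) ys≡ xs≡)
    where
    side-of : ∀ {v x} → x ∈ path v → x ≢ r → side x ≡ side v
    side-of x∈ x≢r with path-side x∈
    ... | inj₁ x≡r = ⊥-elim (x≢r x≡r)
    ... | inj₂ e   = e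
    l∼r : side (Fork.left F) ≡ side (Fork.right F)
    l∼r = trans (side-of (left∈path F) (left≢root F))
                (trans a∼b (sym (side-of (left∈path (fork-sym F)) (left≢root (fork-sym F)))))
    ∉-sibling : ∀ {v w x y s t} → x ≢ y → path v ≡ stem ++ x ∷ s → path w ≡ stem ++ y ∷ t →
                x ∉ path y
    ∉-sibling {v} {w} {x} x≢y ev ew x∈ with ∈-++⁻ stem (subst (x ∈_) (path-through stem ew) x∈)
    ... | inj₁ x∈stem        = unique-∉-prefix stem (subst Unique ev (path-unique v)) x∈stem
    ... | inj₂ (here x≡y)    = x≢y x≡y

  module Order (ρ : Fin n → ℕ) (top : ℕ)
    (ρ-injective : ∀ {x y} → ρ x ≡ ρ y → x ≡ y) (ρ<top : ∀ v → ρ v < top) where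

    open Keys ρ top

    key : Fin n → List ℕ
    key v = keyOf (side v) (path v)

    infix 4 _⊏_
    _⊏_ : Fin n → Fin n → Set
    a ⊏ b = key a ≺ key b

    ⊏-isStrictTotalOrder : IsStrictTotalOrder _≡_ _⊏_
    ⊏-isStrictTotalOrder = injective⇒isStrictTotalOrder ≺-isStrictTotalOrder key
      (λ e → path-injective (keyOf-injective ρ-injective (Pointwise-≡⇒≡ e)))

    open IsStrictTotalOrder ⊏-isStrictTotalOrder public using () renaming (asym to ⊏-asym; irrefl to ⊏-irrefl)

    private
      key≡ : ∀ {v s xs} → side v ≡ s → path v ≡ xs → key v ≡ keyOf s xs
      key≡ = cong₂ keyOf

      by-keys : ∀ {a b k l} → key a ≡ k → key b ≡ l → k ≺ l → a ⊏ b
      by-keys ea eb = subst₂ _≺_ (sym ea) (sym eb)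

    up⊏down : ∀ {a b} → side a ≡ up → side b ≡ down → a ⊏ b
    up⊏down sa sb = by-keys (key≡ sa refl) (key≡ sb refl) (keyOf-up-down _ _)

    ancestor-up : ∀ {a b} → a ∈ path b → a ≢ b → side a ≡ up → a ⊏ b
    ancestor-up {a} a∈ a≢b sa with proper-prefix a∈ a≢b | path-side a∈
    ... | _ , _ , _ | inj₁ refl = case trans (sym sa) root-down of λ ()
    ... | _ , t , e | inj₂ a∼b  =
      by-keys (key≡ sa refl) (key≡ (trans (sym a∼b) sa) e) (keyOf-extension-up (path a) t)

    ancestor-down : ∀ {a b} → a ∈ path b → a ≢ b → side a ≡ down → b ⊏ a
    ancestor-down {a} {b} a∈ a≢b sa = by-side (side b) refl
      where
      by-side : ∀ s → side b ≡ s → b ⊏ a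
      by-side up   sb = up⊏down sb sa
      by-side down sb with proper-prefix a∈ a≢b
      ... | y , t , e = by-keys (key≡ sb e) (key≡ sa refl) (keyOf-extension-down (path a) t (ρ<top y))

    fork-⊏ : ∀ {a b} → side a ≡ side b → (F : Fork (path a) (path b)) →
             ρ (Fork.left F) < ρ (Fork.right F) → a ⊏ b
    fork-⊏ {a} a∼b (fork c _ xs≡ ys≡) lt =
      by-keys (key≡ refl xs≡) (key≡ (sym a∼b) ys≡) (keyOf-fork (side a) c _ _ lt)

  Chain : Subset n → Set
  Chain T = ∀ a b → a ∈ₛ T → b ∈ₛ T → a ≢ b → Comparable a b

  module MaximumChain (S : Subset n) (S-chain : Chain S)
    (S-maximum : ∀ T → Chain T → ∣ T ∣ ≤ ∣ S ∣) where

    ∈-maximum : ∀ {x} → (∀ s → s ∈ₛ S → s ≢ x → Comparable x s) → x ∈ₛ S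
    ∈-maximum {x} x∼S with x ∈ₛ? S
    ... | yes x∈S = x∈S
    ... | no x∉S  =
      ⊥-elim (ℕ.<-irrefl refl (ℕ.<-≤-trans (p⊂q⇒∣p∣<∣q∣ S⊂S⁺) (S-maximum S⁺ S⁺-chain)))
      where
      S⁺ = S ∪ ⁅ x ⁆
      S⊂S⁺ : S ⊂ S⁺
      S⊂S⁺ = p⊆p∪q ⁅ x ⁆ , x , q⊆p∪q S ⁅ x ⁆ (x∈⁅x⁆ x) , x∉S
      S⁺-chain : Chain S⁺
      S⁺-chain a b a∈S⁺ b∈S⁺ a≢b with x∈p∪q⁻ S ⁅ x ⁆ a∈S⁺ | x∈p∪q⁻ S ⁅ x ⁆ b∈S⁺
      ... | inj₁ a∈S | inj₁ b∈S = S-chain a b a∈S b∈S a≢b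
      ... | inj₂ a∈x | inj₁ b∈S with x∈⁅y⁆⇒x≡y x a∈x
      ...   | refl = x∼S b b∈S (≢-sym a≢b)
      S⁺-chain a b a∈S⁺ b∈S⁺ a≢b | inj₁ a∈S | inj₂ b∈x with x∈⁅y⁆⇒x≡y x b∈x
      ...   | refl = comparable-sym (x∼S a a∈S a≢b)
      S⁺-chain a b a∈S⁺ b∈S⁺ a≢b | inj₂ a∈x | inj₂ b∈x =
        ⊥-elim (a≢b (trans (x∈⁅y⁆⇒x≡y x a∈x) (sym (x∈⁅y⁆⇒x≡y x b∈x))))

    path-closed : ∀ {a x} → a ∈ₛ S → x ∈ path a → x ∈ₛ S
    path-closed {a} {x} a∈S x∈ = ∈-maximum x∼S
      where
      x∼S : ∀ s → s ∈ₛ S → s ≢ x → Comparable x s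
      x∼S s s∈S _ with a ≟ s
      ... | yes refl = inj₂ (inj₁ x∈)
      ... | no a≢s with S-chain a s a∈S s∈S a≢s
      ...   | inj₂ (inj₁ a∈) = inj₂ (inj₁ (path-trans a∈ x∈))
      ...   | inj₂ (inj₂ s∈) = inj₂ (on-path-comparable x∈ s∈)
      ...   | inj₁ a≁s with path-side x∈
      ...     | inj₁ refl = inj₂ (inj₁ (root∈path s))
      ...     | inj₂ x∼a  = inj₁ (λ x∼s → a≁s (trans (sym x∼a) x∼s))

    fork-∉ : ∀ {a b} → side a ≡ side b → (F : Fork (path a) (path b)) → a ∈ₛ S → Fork.right F ∉ₛ S
    fork-∉ a∼b F a∈S right∈S =
      fork-incomparable a∼b F (S-chain _ _ (path-closed a∈S (left∈path F)) right∈S (Fork.left≢right F))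

    -- Siblings are ordered by rank₁ in the first order and by the reversed rank₂ in the second;
    -- rank₁ puts the vertices of S first.
    private
      rankBy : Bool → Fin n → ℕ
      rankBy true  v = toℕ v
      rankBy false v = n + toℕ v

      rank-gap : ∀ (x y : Fin n) → toℕ x < n + toℕ y
      rank-gap x y = ℕ.<-≤-trans (toℕ<n x) (ℕ.m≤m+n n (toℕ y))

      rankBy-injective : ∀ b c {x y} → rankBy b x ≡ rankBy c y → x ≡ y
      rankBy-injective true  true  e = toℕ-injective e
      rankBy-injective false false e = toℕ-injective (ℕ.+-cancelˡ-≡ n _ _ e)
      rankBy-injective true  false {x} {y} e = ⊥-elim (ℕ.<-irrefl e (rank-gap x y))
      rankBy-injective false true  {x} {y} e = ⊥-elim (ℕ.<-irrefl (sym e) (rank-gap y x))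

      rankBy<n+n : ∀ b v → rankBy b v < n + n
      rankBy<n+n true  v = ℕ.<-≤-trans (toℕ<n v) (ℕ.m≤m+n n n)
      rankBy<n+n false v = ℕ.+-monoʳ-< n (toℕ<n v)

    rank₁ rank₂ : Fin n → ℕ
    rank₁ v = rankBy (lookup S v) v
    rank₂ v = n + n ∸ rank₁ v

    rank₁-injective : ∀ {x y} → rank₁ x ≡ rank₁ y → x ≡ y
    rank₁-injective {x} {y} = rankBy-injective (lookup S x) (lookup S y)

    rank₁<n+n : ∀ v → rank₁ v < n + n
    rank₁<n+n v = rankBy<n+n (lookup S v) v

    rank₂-injective : ∀ {x y} → rank₂ x ≡ rank₂ y → x ≡ y
    rank₂-injective {x} {y} e = rank₁-injective
      (ℕ.∸-cancelˡ-≡ (ℕ.<⇒≤ (rank₁<n+n x)) (ℕ.<⇒≤ (rank₁<n+n y)) e)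

    rank₂-reverses : ∀ {x y} → rank₁ x < rank₁ y → rank₂ y < rank₂ x
    rank₂-reverses {y = y} lt = ℕ.∸-monoʳ-< lt (ℕ.<⇒≤ (rank₁<n+n y))

    rank₁-chain-first : ∀ {x y} → x ∈ₛ S → y ∉ₛ S → rank₁ x < rank₁ y
    rank₁-chain-first {x} {y} x∈S y∉S with lookup S y in ly
    ... | true  = ⊥-elim (y∉S (lookup⇒[]= y S ly))
    ... | false = subst (λ b → rankBy b x < n + toℕ y) (sym ([]=⇒lookup x∈S)) (rank-gap x y)

    module O₁ = Order rank₁ (suc (n + n)) rank₁-injective (λ v → ℕ.m<n⇒m<1+n (rank₁<n+n v))
    module O₂ = Order rank₂ (suc (n + n)) rank₂-injective (λ v → s≤s (ℕ.m∸n≤m (n + n) (rank₁ v)))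

    placement : Bool → Side → Placement
    placement true  down = early
    placement true  up   = late
    placement false _    = twice

    place : Fin n → Placement
    place v = placement (lookup S v) (side v)

    multiplicity-placement : ∀ b s → multiplicity (placement b s) ≡ 2 ∸ indicator b
    multiplicity-placement true  down = refl
    multiplicity-placement true  up   = refl
    multiplicity-placement false _    = refl

    private
      early-placement : ∀ {v} → place v ≡ early → v ∈ₛ S × side v ≡ down
      early-placement {v} = decode (lookup S v) (side v) refl refl
        where
        decode : ∀ b s → lookup S v ≡ b → side v ≡ s → placement b s ≡ early →
                 v ∈ₛ S × side v ≡ down
        decode true  down lv sv _ = lookup⇒[]= v S lv , sv
        decode true  up   _  _  ()
        decode false _    _  _  ()

      late-placement : ∀ {v} → place v ≡ late → v ∈ₛ S × side v ≡ up
      late-placement {v} = decode (lookup S v) (side v) refl refl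
        where
        decode : ∀ b s → lookup S v ≡ b → side v ≡ s → placement b s ≡ late →
                 v ∈ₛ S × side v ≡ up
        decode true  up   lv sv _ = lookup⇒[]= v S lv , sv
        decode true  down _  _  ()
        decode false _    _  _  ()

      twice-placement : ∀ {v} → place v ≡ twice → v ∉ₛ S
      twice-placement {v} = decode (lookup S v) (side v) refl
        where
        decode : ∀ b s → lookup S v ≡ b → placement b s ≡ twice → v ∉ₛ S
        decode true  down _  ()
        decode true  up   _  ()
        decode false _    lv _ v∈S = case trans (sym ([]=⇒lookup v∈S)) lv of λ ()

      once-placement : ∀ {v} → place v ≢ twice → v ∈ₛ S
      once-placement {v} = decode (lookup S v) (side v) refl
        where
        decode : ∀ b s → lookup S v ≡ b → placement b s ≢ twice → v ∈ₛ S
        decode true  _ lv _        = lookup⇒[]= v S lv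
        decode false _ _  ≢twice   = ⊥-elim (≢twice refl)

      side-cases : ∀ v → side v ≡ up ⊎ side v ≡ down
      side-cases v with side v
      ... | up   = inj₁ refl
      ... | down = inj₂ refl

      up-of : ∀ {s t} → s ≡ down → s ≢ t → t ≡ up
      up-of {t = up}   _    _   = refl
      up-of {t = down} refl s≢t = ⊥-elim (s≢t refl)

      down-of : ∀ {s t} → s ≡ up → s ≢ t → t ≡ down
      down-of {t = down} _    _   = refl
      down-of {t = up}   refl s≢t = ⊥-elim (s≢t refl)

      ∈∉⇒≢ : ∀ {a b} → a ∈ₛ S → b ∉ₛ S → a ≢ b
      ∈∉⇒≢ a∈S b∉S refl = b∉S a∈S

    fork-rank₁ : ∀ {a b} → side a ≡ side b → (F : Fork (path a) (path b)) → a ∈ₛ S →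
                 rank₁ (Fork.left F) < rank₁ (Fork.right F)
    fork-rank₁ a∼b F a∈S = rank₁-chain-first (path-closed a∈S (left∈path F)) (fork-∉ a∼b F a∈S)

    once-comparable : ∀ {a b} → a ≢ b → place a ≢ twice → place b ≢ twice → Comparable a b
    once-comparable a≢b pa pb = S-chain _ _ (once-placement pa) (once-placement pb) a≢b

    early-twice : ∀ {a b} → place a ≡ early → place b ≡ twice → Comparable a b ⇔ b O₁.⊏ a
    early-twice {a} {b} pa pb with early-placement pa | twice-placement pb | position a b
    ... | a∈S , sa | b∉S | ancestor a∈   =
      both⇔ (inj₂ (inj₁ a∈)) (O₁.ancestor-down a∈ (∈∉⇒≢ a∈S b∉S) sa)
    ... | a∈S , _  | b∉S | descendant b∈ = ⊥-elim (b∉S (path-closed a∈S b∈))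
    ... | _   , sa | _   | opposite a≁b  = both⇔ (inj₁ a≁b) (O₁.up⊏down (up-of sa a≁b) sa)
    ... | a∈S , _  | _   | branching a∼b a∉ b∉ F = neither⇔ (branching-incomparable a∼b a∉ b∉)
      (O₁.⊏-asym (O₁.fork-⊏ a∼b F (fork-rank₁ a∼b F a∈S)))

    late-twice : ∀ {a b} → place a ≡ late → place b ≡ twice → Comparable a b ⇔ a O₂.⊏ b
    late-twice {a} {b} pa pb with late-placement pa | twice-placement pb | position a b
    ... | a∈S , sa | b∉S | ancestor a∈   =
      both⇔ (inj₂ (inj₁ a∈)) (O₂.ancestor-up a∈ (∈∉⇒≢ a∈S b∉S) sa)
    ... | a∈S , _  | b∉S | descendant b∈ = ⊥-elim (b∉S (path-closed a∈S b∈))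
    ... | _   , sa | _   | opposite a≁b  = both⇔ (inj₁ a≁b) (O₂.up⊏down sa (down-of sa a≁b))
    ... | a∈S , _  | _   | branching a∼b a∉ b∉ F = neither⇔ (branching-incomparable a∼b a∉ b∉)
      (λ a⊏b → O₂.⊏-asym a⊏b
        (O₂.fork-⊏ (sym a∼b) (fork-sym F) (rank₂-reverses (fork-rank₁ a∼b F a∈S))))

    twice-twice : ∀ {a b} → place a ≡ twice → place b ≡ twice → a O₁.⊏ b →
                  Comparable a b ⇔ a O₂.⊏ b
    twice-twice {a} {b} _ _ a⊏₁b = by-position (position a b)
      where
      a≢b : a ≢ b
      a≢b refl = O₁.⊏-irrefl refl a⊏₁b

      impossible : ∀ {P : Set} → b O₁.⊏ a → P
      impossible b⊏₁a = ⊥-elim (O₁.⊏-asym a⊏₁b b⊏₁a)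

      by-position : Position a b → Comparable a b ⇔ a O₂.⊏ b
      by-position (ancestor a∈) with side-cases a
      ... | inj₁ sa = both⇔ (inj₂ (inj₁ a∈)) (O₂.ancestor-up a∈ a≢b sa)
      ... | inj₂ sa = impossible (O₁.ancestor-down a∈ a≢b sa)
      by-position (descendant b∈) with side-cases b
      ... | inj₁ sb = impossible (O₁.ancestor-up b∈ (≢-sym a≢b) sb)
      ... | inj₂ sb = both⇔ (inj₂ (inj₂ b∈)) (O₂.ancestor-down b∈ (≢-sym a≢b) sb)
      by-position (opposite a≁b) with side-cases a
      ... | inj₁ sa = both⇔ (inj₁ a≁b) (O₂.up⊏down sa (down-of sa a≁b))
      ... | inj₂ sa = impossible (O₁.up⊏down (up-of sa a≁b) sa)
      by-position (branching a∼b a∉ b∉ F) with ℕ.<-cmp (rank₁ (Fork.left F)) (rank₁ (Fork.right F))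
      ... | tri< lt _ _ = neither⇔ (branching-incomparable a∼b a∉ b∉)
        (λ a⊏₂b → O₂.⊏-asym a⊏₂b (O₂.fork-⊏ (sym a∼b) (fork-sym F) (rank₂-reverses lt)))
      ... | tri≈ _ eq _ = ⊥-elim (Fork.left≢right F (rank₁-injective eq))
      ... | tri> _ _ gt = impossible (O₁.fork-⊏ (sym a∼b) (fork-sym F) gt)

    open TwoOrderWord Comparable comparable-sym O₁.⊏-isStrictTotalOrder O₂.⊏-isStrictTotalOrder
      place once-comparable early-twice late-twice twice-twice public
      using (word; count-word; word-alternation)

    word-complete : ∀ v → v ∈ word
    word-complete v = 1≤count⇒∈ word (subst (1 ≤_) (sym (count-word v)) (1≤multiplicity (place v)))

    length-word : length word ≡ 2 * n ∸ ∣ S ∣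
    length-word = begin
      length word                             ≡⟨ length≡∑count word ⟩
      sum (λ v → count v word)                ≡⟨ sum-cong-≗ (λ v → trans (count-word v)
                                                  (multiplicity-placement (lookup S v) (side v))) ⟩
      sum (λ v → 2 ∸ indicator (lookup S v))  ≡⟨ ∑-2∸indicator S ⟩
      2 * n ∸ ∣ S ∣                           ∎
      where open ≡-Reasoning

-- Simple paths in acyclic graphs

module _ {A : Set} where

  final : A → List A → A
  final x []      = x
  final _ (y ∷ l) = final y l

  final-∈ : ∀ x l → final x l ∈ x ∷ l
  final-∈ x []      = here refl
  final-∈ x (y ∷ l) = there (final-∈ y l)

  final-++ : ∀ x l m → final x (l ++ m) ≡ final (final x l) m
  final-++ x []      m = refl
  final-++ x (y ∷ l) m = final-++ y l m

  final-∷ʳ : ∀ x l → ∃ λ q → x ∷ l ≡ q ∷ʳ final x l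
  final-∷ʳ x []      = [] , refl
  final-∷ʳ x (y ∷ l) with final-∷ʳ y l
  ... | q , e = x ∷ q , cong (x ∷_) e

  final-suffix : ∀ xs {x l y ys} → x ∷ l ≡ xs ++ y ∷ ys → final x l ≡ final y ys
  final-suffix []       e with ∷-injective e
  ... | refl , refl = refl
  final-suffix (_ ∷ xs) {x} {y = y} {ys} e with ∷-injective e
  ... | refl , refl = final-++ x xs (y ∷ ys)

  unique-++⁻ˡ : ∀ (xs : List A) {ys} → Unique (xs ++ ys) → Unique xs
  unique-++⁻ˡ []       _          = []
  unique-++⁻ˡ (x ∷ xs) (x∉ ∷ uniq) = AllP.++⁻ˡ xs x∉ ∷ unique-++⁻ˡ xs uniq

  unique-++⁻ʳ : ∀ (xs : List A) {ys} → Unique (xs ++ ys) → Unique ys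
  unique-++⁻ʳ []       uniq       = uniq
  unique-++⁻ʳ (x ∷ xs) (_ ∷ uniq) = unique-++⁻ʳ xs uniq

module _ {A : Set} {R : A → A → Set} where

  Linked-++⁻ˡ : ∀ xs {ys} → Linked R (xs ++ ys) → Linked R xs
  Linked-++⁻ˡ []           _        = []
  Linked-++⁻ˡ (x ∷ [])     _        = [-]
  Linked-++⁻ˡ (x ∷ y ∷ xs) (r ∷ rs) = r ∷ Linked-++⁻ˡ (y ∷ xs) rs

  Linked-++⁻ʳ : ∀ xs {ys} → Linked R (xs ++ ys) → Linked R ys
  Linked-++⁻ʳ []       rs = rs
  Linked-++⁻ʳ (x ∷ xs) rs = Linked-++⁻ʳ xs (Linked.tail rs)

  Linked-join : ∀ xs {z ys} → Linked R (xs ∷ʳ z) → Linked R (z ∷ ys) → Linked R (xs ++ z ∷ ys)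
  Linked-join []           _        rs′ = rs′
  Linked-join (x ∷ [])     (r ∷ _)  rs′ = r ∷ rs′
  Linked-join (x ∷ y ∷ xs) (r ∷ rs) rs′ = r ∷ Linked-join (y ∷ xs) rs rs′

  Linked-append : ∀ {x l m} → Linked R (x ∷ l) → Linked R (final x l ∷ m) → Linked R (x ∷ l ++ m)
  Linked-append {l = []}    _        rs′ = rs′
  Linked-append {l = _ ∷ _} (r ∷ rs) rs′ = r ∷ Linked-append rs rs′

  Linked-reverse : ∀ {xs} → Linked R xs → Linked (flip R) (reverse xs)
  Linked-reverse []        = []
  Linked-reverse [-]       = [-]
  Linked-reverse (r ∷ rs)  = reverseAcc⁺ (r ∷ [-]) rs
    where
    reverseAcc⁺ : ∀ {x acc xs} → Linked (flip R) (x ∷ acc) → Linked R (x ∷ xs) →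
                  Linked (flip R) (reverseAcc (x ∷ acc) xs)
    reverseAcc⁺ k [-]      = k
    reverseAcc⁺ k (r ∷ rs) = reverseAcc⁺ (r ∷ k) rs

  Linked-head : (∀ {a b c} → R a b → R b c → R a c) → ∀ {x l v} → Linked R (x ∷ l) → v ∈ x ∷ l →
                v ≡ x ⊎ R x v
  Linked-head trans rs (here refl) = inj₁ refl
  Linked-head trans rs (there v∈)  = inj₂ (All.lookup (AllPairs.head (Linked⇒AllPairs trans rs)) v∈)

  Linked-final : (∀ {a b c} → R a b → R b c → R a c) → ∀ {x l v} → Linked R (x ∷ l) → v ∈ x ∷ l →
                 v ≡ final x l ⊎ R v (final x l)
  Linked-final trans [-]              (here refl) = inj₁ refl
  Linked-final trans {x} (r ∷ rs)     (here refl) with Linked-final trans rs (here refl)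
  ... | inj₁ e  = inj₂ (subst (R x) e r)
  ... | inj₂ r′ = inj₂ (trans r r′)
  Linked-final trans (_ ∷ rs)         (there v∈) = Linked-final trans rs v∈

1≤length-++∷ : ∀ {A : Set} (xs : List A) {y ys} → 1 ≤ length (xs ++ y ∷ ys)
1≤length-++∷ []      = s≤s z≤n
1≤length-++∷ (_ ∷ _) = s≤s z≤n

fork-length : ∀ {A : Set} {p q z : A} {l₁ l₂ β δ} α γ → p ≢ q →
              p ∷ l₁ ≡ α ++ z ∷ β → q ∷ l₂ ≡ γ ++ z ∷ δ → 2 ≤ length (α ++ z ∷ reverse γ)
fork-length []      []       p≢q eP eQ = ⊥-elim (p≢q (trans (∷-injectiveˡ eP) (sym (∷-injectiveˡ eQ))))
fork-length []      (g ∷ γ)  _   _  _  =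
  s≤s (subst (λ l → 1 ≤ length l) (sym (unfold-reverse g γ)) (1≤length-++∷ (reverse γ)))
fork-length (_ ∷ α) _        _   _  _  = s≤s (1≤length-++∷ α)

module _ {n : ℕ} where

  open import Data.List.Membership.DecPropositional (_≟_ {n}) using (_∈?_)

  first-common : ∀ (xs ys : List (Fin n)) → Any (_∈ ys) xs →
                 ∃₂ λ α z → ∃ λ β → xs ≡ α ++ z ∷ β × z ∈ ys × All (_∉ ys) α
  first-common (x ∷ xs) ys common with x ∈? ys
  ... | yes x∈ys = [] , x , xs , refl , x∈ys , []
  first-common (x ∷ xs) ys (here x∈ys)  | no x∉ys = ⊥-elim (x∉ys x∈ys)
  first-common (x ∷ xs) ys (there common) | no x∉ys with first-common xs ys common
  ... | α , z , β , refl , z∈ys , α∉ys = x ∷ α , z , β , refl , z∈ys , x∉ys ∷ α∉ys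

  loop-erase : ∀ {H : Fin n → Fin n → Set} {x y} → Walk H x y →
               ∃ λ l → Unique (x ∷ l) × Linked H (x ∷ l) × final x l ≡ y
  loop-erase here = [] , [] ∷ [] , [-] , refl
  loop-erase {H = H} {x} (step {c = c} h walk) with loop-erase walk
  ... | l , uniq , linked , ends with x ∈? c ∷ l
  ...   | no x∉ = c ∷ l , AllP.¬Any⇒All¬ (c ∷ l) x∉ ∷ uniq , h ∷ linked , ends
  ...   | yes x∈ with ∈-∃++ x∈
  ...     | α , β , e =
    β , unique-++⁻ʳ α (subst Unique e uniq) , Linked-++⁻ʳ α (subst (Linked H) e linked) ,
    trans (sym (final-suffix α e)) ends

  module SimplePaths {H : Fin n → Fin n → Set} (H-sym : ∀ {a b} → H a b → H b a) (acyclic : Acyclic H) where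

    open import Data.List.Relation.Binary.Permutation.Setoid (setoid (Fin n)) using (↭-sym)
    open import Data.List.Relation.Binary.Permutation.Setoid.Properties (setoid (Fin n))
      using (Unique-resp-↭; ↭-reverse)

    -- With z the first vertex of the first path lying on the second, the cycle runs from x to z
    -- along the first path and back to x along the second.
    fork-cycle : ∀ {x p q l₁ l₂} → p ≢ q → Unique (x ∷ p ∷ l₁) → Linked H (x ∷ p ∷ l₁) →
                 Unique (x ∷ q ∷ l₂) → Linked H (x ∷ q ∷ l₂) → final p l₁ ∈ q ∷ l₂ →
                 ∃ λ ys → IsCycle H x ys
    fork-cycle {x} {p} {q} {l₁} {l₂} p≢q uP kP uQ kQ y∈Q
      with first-common (p ∷ l₁) (q ∷ l₂) (Any.map (λ { refl → y∈Q }) (final-∈ p l₁))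
    ... | α , z , β , eP , z∈Q , α∉Q with ∈-∃++ z∈Q
    ...   | γ , δ , eQ = α ++ z ∷ reverse γ , unique , long , linked
      where
      uP′ : Unique (x ∷ α ++ z ∷ β)
      uP′ = subst (Unique ∘ (x ∷_)) eP uP
      uQ′ : Unique (x ∷ γ ++ z ∷ δ)
      uQ′ = subst (Unique ∘ (x ∷_)) eQ uQ
      x-to-z : ∀ {xs ys} → Linked H (x ∷ xs ++ z ∷ ys) → Linked H ((x ∷ xs) ∷ʳ z)
      x-to-z {xs} {ys} k =
        Linked-++⁻ˡ ((x ∷ xs) ∷ʳ z) (subst (Linked H) (sym (++-assoc (x ∷ xs) [ z ] ys)) k)
      z-to-x : Linked H (z ∷ reverse γ ∷ʳ x)
      z-to-x = subst (Linked H) (trans (reverse-++ (x ∷ γ) [ z ]) (cong (z ∷_) (unfold-reverse x γ)))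
                 (Linked.map H-sym (Linked-reverse (x-to-z (subst (Linked H ∘ (x ∷_)) eQ kQ))))
      linked : Linked H (x ∷ (α ++ z ∷ reverse γ) ++ [ x ])
      linked = subst (Linked H ∘ (x ∷_)) (sym (++-assoc α (z ∷ reverse γ) [ x ]))
                 (Linked-join (x ∷ α) (x-to-z (subst (Linked H ∘ (x ∷_)) eP kP)) z-to-x)
      disjoint : ∀ {v} → ¬ (v ∈ (x ∷ α) ∷ʳ z × v ∈ reverse γ)
      disjoint (v∈ , v∈rev) with AnyP.reverse⁻ v∈rev | ∈-++⁻ (x ∷ α) v∈
      ... | v∈γ | inj₁ (here refl)   = All.lookup (AllPairs.head uQ′) (∈-++⁺ˡ v∈γ) refl
      ... | v∈γ | inj₁ (there v∈α)   = All.lookup α∉Q v∈α (subst (_ ∈_) (sym eQ) (∈-++⁺ˡ v∈γ))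
      ... | v∈γ | inj₂ (here refl)   = unique-∉-prefix γ (AllPairs.tail uQ′) v∈γ
      unique : Unique (x ∷ α ++ z ∷ reverse γ)
      unique = subst Unique (++-assoc (x ∷ α) [ z ] (reverse γ))
        (Unique.++⁺ (unique-++⁻ˡ ((x ∷ α) ∷ʳ z) (subst Unique (sym (++-assoc (x ∷ α) [ z ] β)) uP′))
                    (Unique-resp-↭ (↭-sym (↭-reverse γ)) (unique-++⁻ˡ γ (AllPairs.tail uQ′)))
                    disjoint)
      long = fork-length α γ p≢q eP eQ

    simple-paths-unique : ∀ {x l₁ l₂} → Unique (x ∷ l₁) → Linked H (x ∷ l₁) →
                          Unique (x ∷ l₂) → Linked H (x ∷ l₂) → final x l₁ ≡ final x l₂ → l₁ ≡ l₂
    simple-paths-unique {l₁ = []}     {[]}     _  _  _  _  _ = refl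
    simple-paths-unique {l₁ = []}     {q ∷ l₂} _  _  u₂ _  e =
      ⊥-elim (All.lookup (AllPairs.head u₂) (subst (_∈ q ∷ l₂) (sym e) (final-∈ q l₂)) refl)
    simple-paths-unique {l₁ = p ∷ l₁} {[]}     u₁ _  _  _  e =
      ⊥-elim (All.lookup (AllPairs.head u₁) (subst (_∈ p ∷ l₁) e (final-∈ p l₁)) refl)
    simple-paths-unique {x} {p ∷ l₁} {q ∷ l₂} u₁ k₁ u₂ k₂ e with p ≟ q
    ... | yes refl = cong (p ∷_)
      (simple-paths-unique (AllPairs.tail u₁) (Linked.tail k₁) (AllPairs.tail u₂) (Linked.tail k₂) e)
    ... | no p≢q with fork-cycle p≢q u₁ k₁ u₂ k₂ (subst (_∈ q ∷ l₂) (sym e) (final-∈ q l₂))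
    ...   | ys , cycle = ⊥-elim (acyclic x ys cycle)

    simple-path-prefix : ∀ {x l m v} → Unique (x ∷ l) → Linked H (x ∷ l) →
                         Unique (x ∷ m) → Linked H (x ∷ m) → final x m ≡ v → v ∈ x ∷ l →
                         ∃ λ t → x ∷ l ≡ (x ∷ m) ++ t
    simple-path-prefix {x} {l} {m} uₗ kₗ uₘ kₘ eₘ v∈ with ∈-∃++ v∈
    ... | [] , β , e with ∷-injective e
    ...   | refl , refl = l , cong (λ m → x ∷ m ++ l) (sym (simple-paths-unique uₘ kₘ ([] ∷ []) [-] eₘ))
    simple-path-prefix {x} {l} {m} uₗ kₗ uₘ kₘ eₘ v∈ | _ ∷ α , β , e with ∷-injective e
    ... | refl , refl = β , cong (x ∷_) (trans (sym (++-assoc α [ _ ] β)) (cong (_++ β) α∷ʳv≡m))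
      where
      split = sym (++-assoc (x ∷ α) [ _ ] β)
      α∷ʳv≡m = simple-paths-unique
                 (unique-++⁻ˡ (x ∷ α ∷ʳ _) (subst Unique split uₗ))
                 (Linked-++⁻ˡ (x ∷ α ∷ʳ _) (subst (Linked H) split kₗ))
                 uₘ kₘ (trans (final-++ x α [ _ ]) (sym eₘ))

-- Root paths in a Hasse tree

¬¬-Π : ∀ {m} {Q : Fin m → Set} → (∀ i → ¬ ¬ Q i) → ¬ ¬ (∀ i → Q i)
¬¬-Π {zero}      _ k = k λ ()
¬¬-Π {suc m} {Q} f k = f zero λ q₀ → ¬¬-Π (f ∘ suc) λ qs → k λ { zero → q₀ ; (suc i) → qs i }

module HassePaths {n : ℕ} (Q : StrictPartialOrder n) {H : Fin n → Fin n → Set}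
  (H-sym    : ∀ {a b} → H a b → H b a)
  (acyclic  : Acyclic H)
  (orient   : ∀ {a b} → H a b → Covers Q a b ⊎ Covers Q b a)
  (cover⇒H  : ∀ {a b} → Covers Q a b → H a b)
  (r : Fin n) (tl : Fin n → List (Fin n))
  (tl-unique : ∀ a → Unique (r ∷ tl a))
  (tl-linked : ∀ a → Linked H (r ∷ tl a))
  (tl-final  : ∀ a → final r (tl a) ≡ a)
  where

  open SimplePaths H-sym acyclic
  open import Data.List.Membership.DecPropositional (_≟_ {n}) using (_∈?_)

  private
    _◁_ = _<ₚ_ Q

    isStrictPartialOrder : IsStrictPartialOrder _≡_ _◁_
    isStrictPartialOrder = record
      { isEquivalence = isEquivalence
      ; irrefl        = λ { refl → irreflₚ Q }
      ; trans         = transₚ Q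
      ; <-resp-≈      = (λ { refl lt → lt }) , (λ { refl lt → lt })
      }

    >-trans : ∀ {a b c} → b ◁ a → c ◁ b → c ◁ a
    >-trans b<a c<b = transₚ Q c<b b<a

  -- The order of Q need not be decidable, but descending? only inspects the orientation of the
  -- Hasse edges, so facts about it may be proved assuming a decidable order: on a finite set
  -- that assumption holds up to double negation.
  descending? : ∀ {l} → Linked H l → Bool
  descending? []      = true
  descending? [-]     = true
  descending? (h ∷ k) with orient h
  ... | inj₁ _ = false
  ... | inj₂ _ = descending? k

  descending?-sound : ∀ {l} (k : Linked H l) → descending? k ≡ true → Linked (flip _◁_) l
  descending?-sound []      _ = []
  descending?-sound [-]     _ = [-]
  descending?-sound (h ∷ k) e with orient h
  ... | inj₂ (b<a , _) = b<a ∷ descending?-sound k e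

  descending?-complete : ∀ {l} (k : Linked H l) → Linked (flip _◁_) l → descending? k ≡ true
  descending?-complete []      _          = refl
  descending?-complete [-]     _          = refl
  descending?-complete (h ∷ k) (b<a ∷ k′) with orient h
  ... | inj₁ (a<b , _) = ⊥-elim (irreflₚ Q (transₚ Q a<b b<a))
  ... | inj₂ _         = descending?-complete k k′

  descending⇒unique : ∀ {l} → Linked (flip _◁_) l → Unique l
  descending⇒unique k = AllPairs.map (λ { b<a refl → irreflₚ Q b<a }) (Linked⇒AllPairs >-trans k)

  covers⇒H-path : ∀ {l} → Linked (flip (Covers Q)) l → Linked H l
  covers⇒H-path = Linked.map (H-sym ∘ cover⇒H)

  CoverChain : Fin n → Fin n → Set
  CoverChain b a = ∃ λ m → Linked (flip (Covers Q)) (b ∷ m) × final b m ≡ a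

  module _ (dec : ∀ a b → Dec (a ◁ b)) where

    cover-chain : ∀ {a b} → Acc (flip _◁_) a → Acc _◁_ b → a ◁ b → CoverChain b a
    cover-chain {a} {b} (acc above) (acc below) a<b with any? (λ c → dec a c ×-dec dec c b)
    ... | no ¬between = a ∷ [] , (a<b , λ c between → ¬between (c , between)) ∷ [-] , refl
    ... | yes (c , a<c , c<b)
      with cover-chain (above a<c) (acc below) c<b | cover-chain (acc above) (below c<b) a<c
    ...   | m₁ , k₁ , e₁ | m₂ , k₂ , e₂ =
      m₁ ++ m₂ , Linked-append k₁ (subst (λ z → Linked _ (z ∷ m₂)) (sym e₁) k₂) ,
      trans (final-++ b m₁ m₂) (trans (cong (λ z → final z m₂) e₁) e₂)

    cover-chain′ : ∀ {a b} → a ◁ b → CoverChain b a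
    cover-chain′ {a} {b} =
      cover-chain (spo-noetherian isStrictPartialOrder a) (spo-wellFounded isStrictPartialOrder b)

    descending-path-is-root-path : ∀ {a m} → Linked (flip _◁_) (r ∷ m) → Linked H (r ∷ m) →
                                   final r m ≡ a → tl a ≡ m
    descending-path-is-root-path {a} desc linked e =
      simple-paths-unique (tl-unique a) (tl-linked a) (descending⇒unique desc) linked (trans (tl-final a) (sym e))

    root-path-descends-dec : ∀ {a} → a ◁ r → descending? (tl-linked a) ≡ true
    root-path-descends-dec {a} a<r with cover-chain′ a<r
    ... | m , chain , e =
      descending?-complete (tl-linked a)
        (subst (Linked (flip _◁_) ∘ (r ∷_))
               (sym (descending-path-is-root-path desc (covers⇒H-path chain) e)) desc)
      where desc = Linked.map proj₁ chain

    root-path-through-dec : ∀ {a b} → a ◁ b → b ◁ r → b ∈ r ∷ tl a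
    root-path-through-dec {a} {b} a<b b<r with cover-chain′ a<b
    ... | m , chain , e =
      subst (λ l → b ∈ r ∷ l) (sym tl-a) (∈-++⁺ˡ (subst (_∈ r ∷ tl b) (tl-final b) (final-∈ r (tl b))))
      where
      to-b : final r (tl b) ∷ m ≡ b ∷ m
      to-b = cong (_∷ m) (tl-final b)
      desc : Linked (flip _◁_) (r ∷ tl b ++ m)
      desc = Linked-append (descending?-sound (tl-linked b) (root-path-descends-dec b<r))
                           (subst (Linked (flip _◁_)) (sym to-b) (Linked.map proj₁ chain))
      linked : Linked H (r ∷ tl b ++ m)
      linked = Linked-append (tl-linked b) (subst (Linked H) (sym to-b) (covers⇒H-path chain))
      tl-a : tl a ≡ tl b ++ m
      tl-a = descending-path-is-root-path desc linked
               (trans (final-++ r (tl b) m) (trans (cong (λ z → final z m) (tl-final b)) e))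

  private
    ¬¬-decidable : ¬ ¬ (∀ a b → Dec (a ◁ b))
    ¬¬-decidable = ¬¬-Π λ a → ¬¬-Π λ b → ¬¬-excluded-middle

    by-decidability : ∀ {P : Set} → Dec P → ((∀ a b → Dec (a ◁ b)) → P) → P
    by-decidability P? f = decidable-stable P? (λ ¬p → ¬¬-decidable (¬p ∘ f))

  root-path-descends : ∀ {a} → a ◁ r → Linked (flip _◁_) (r ∷ tl a)
  root-path-descends {a} a<r = descending?-sound (tl-linked a)
    (by-decidability (descending? (tl-linked a) Bool.≟ true) (λ dec → root-path-descends-dec dec a<r))

  root-path-through : ∀ {a b} → a ◁ b → b ◁ r → b ∈ r ∷ tl a
  root-path-through {a} {b} a<b b<r =
    by-decidability (b ∈? r ∷ tl a) (λ dec → root-path-through-dec dec a<b b<r)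

-- Double arborescences

dual : ∀ {n} → StrictPartialOrder n → StrictPartialOrder n
dual Q = record { _<ₚ_ = flip (_<ₚ_ Q) ; irreflₚ = irreflₚ Q ; transₚ = λ b<a c<b → transₚ Q c<b b<a }

Covers-dual : ∀ {n} {Q : StrictPartialOrder n} {a b} → Covers Q a b → Covers (dual Q) b a
Covers-dual (a<b , nothing-between) = a<b , λ { c (c<b , a<c) → nothing-between c (a<c , c<b) }

module Arborescence {n : ℕ} (G : Graph n) (P : StrictPartialOrder n)
  (orientation : IsTransitiveOrientation G P) (connected : Connected (HasseUndirected P))
  (acyclic : Acyclic (HasseUndirected P)) (r : Fin n) (universal : ∀ v → v ≢ r → Adj G r v)
  where

  private
    _◁_ = _<ₚ_ P
    Hasse = HasseUndirected P

    Hasse-sym : ∀ {a b} → Hasse a b → Hasse b a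
    Hasse-sym = swap

    Hasse-dual : ∀ {a b} → Hasse a b → Covers (dual P) a b ⊎ Covers (dual P) b a
    Hasse-dual (inj₁ a⋖b) = inj₂ (Covers-dual {Q = P} a⋖b)
    Hasse-dual (inj₂ b⋖a) = inj₁ (Covers-dual {Q = P} b⋖a)

    dual⇒Hasse : ∀ {a b} → Covers (dual P) a b → Hasse a b
    dual⇒Hasse = inj₂ ∘ Covers-dual {Q = dual P}

    tl : Fin n → List (Fin n)
    tl a = proj₁ (loop-erase (connected r a))

    tl-unique : ∀ a → Unique (r ∷ tl a)
    tl-unique a = proj₁ (proj₂ (loop-erase (connected r a)))

    tl-linked : ∀ a → Linked Hasse (r ∷ tl a)
    tl-linked a = proj₁ (proj₂ (proj₂ (loop-erase (connected r a))))

    tl-final : ∀ a → final r (tl a) ≡ a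
    tl-final a = proj₂ (proj₂ (proj₂ (loop-erase (connected r a))))

    module Below = HassePaths P Hasse-sym acyclic id inj₁ r tl tl-unique tl-linked tl-final
    module Above = HassePaths (dual P) Hasse-sym acyclic Hasse-dual dual⇒Hasse r tl tl-unique tl-linked tl-final
    open SimplePaths Hasse-sym acyclic

  path : Fin n → List (Fin n)
  path a = r ∷ tl a

  data Location (v : Fin n) : Set where
    root  : v ≡ r → Location v
    below : v ◁ r → Location v
    above : r ◁ v → Location v

  location : ∀ v → Location v
  location v with v ≟ r
  ... | yes v≡r = root v≡r
  ... | no v≢r with Equivalence.to (orientation r v) (universal v v≢r)
  ...   | inj₁ r<v = above r<v
  ...   | inj₂ v<r = below v<r

  side-of : ∀ {v} → Location v → Side
  side-of (root _)  = down
  side-of (below _) = down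
  side-of (above _) = up

  side : Fin n → Side
  side v = side-of (location v)

  side-root : side r ≡ down
  side-root with location r
  ... | root _    = refl
  ... | below r<r = ⊥-elim (irreflₚ P r<r)
  ... | above r<r = ⊥-elim (irreflₚ P r<r)

  side-below : ∀ {v} → v ◁ r → side v ≡ down
  side-below {v} v<r with location v
  ... | root _    = refl
  ... | below _   = refl
  ... | above r<v = ⊥-elim (irreflₚ P (transₚ P v<r r<v))

  side-above : ∀ {v} → r ◁ v → side v ≡ up
  side-above {v} r<v with location v
  ... | root refl = ⊥-elim (irreflₚ P r<v)
  ... | below v<r = ⊥-elim (irreflₚ P (transₚ P v<r r<v))
  ... | above _   = refl

  private
    tl-root : tl r ≡ []
    tl-root = simple-paths-unique (tl-unique r) (tl-linked r) ([] ∷ []) [-] (tl-final r)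

    on-root-path : ∀ {x} → x ∈ path r → x ≡ r
    on-root-path x∈ with subst (λ l → _ ∈ r ∷ l) tl-root x∈
    ... | here x≡r = x≡r

    path-to : ∀ a → ∃ λ q → path a ≡ q ∷ʳ a
    path-to a with final-∷ʳ r (tl a)
    ... | q , e = q , trans e (cong (q ∷ʳ_) (tl-final a))

    path-prefix : ∀ {a b} → b ∈ path a → ∃ λ t → path a ≡ path b ++ t
    path-prefix {a} {b} = simple-path-prefix (tl-unique a) (tl-linked a) (tl-unique b) (tl-linked b) (tl-final b)

    path-side : ∀ {a x} → x ∈ path a → x ≡ r ⊎ side x ≡ side a
    path-side {a} {x} x∈ = by-location (location a)
      where
      by-location : Location a → x ≡ r ⊎ side x ≡ side a
      by-location (root refl) = inj₁ (on-root-path x∈)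
      by-location (below a<r) with Linked-head (λ p q → transₚ P q p) (Below.root-path-descends a<r) x∈
      ... | inj₁ x≡r = inj₁ x≡r
      ... | inj₂ x<r = inj₂ (trans (side-below x<r) (sym (side-below a<r)))
      by-location (above r<a) with Linked-head (transₚ P) (Above.root-path-descends r<a) x∈
      ... | inj₁ x≡r = inj₁ x≡r
      ... | inj₂ r<x = inj₂ (trans (side-above r<x) (sym (side-above r<a)))

  open DoubleTree r side path side-root (λ a → tl a , refl) path-to tl-unique path-prefix path-side public

  private
    adjacent-< : ∀ {a b} → a ◁ b → Adj G a b
    adjacent-< a<b = Equivalence.from (orientation _ _) (inj₁ a<b)

    adjacent-> : ∀ {a b} → b ◁ a → Adj G a b
    adjacent-> b<a = Equivalence.from (orientation _ _) (inj₂ b<a)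

    ancestor-adjacent : ∀ {a b} → a ≢ b → a ∈ path b → Adj G a b
    ancestor-adjacent {a} {b} a≢b a∈ = by-location (location b)
      where
      by-location : Location b → Adj G a b
      by-location (root refl) = ⊥-elim (a≢b (on-root-path a∈))
      by-location (below b<r) with Linked-final (λ p q → transₚ P q p) (Below.root-path-descends b<r) a∈
      ... | inj₁ a≡b = ⊥-elim (a≢b (trans a≡b (tl-final b)))
      ... | inj₂ b<a = adjacent-> (subst (_◁ a) (tl-final b) b<a)
      by-location (above r<b) with Linked-final (transₚ P) (Above.root-path-descends r<b) a∈
      ... | inj₁ a≡b = ⊥-elim (a≢b (trans a≡b (tl-final b)))
      ... | inj₂ a<b = adjacent-< (subst (a ◁_) (tl-final b) a<b)

    opposite-adjacent : ∀ {a b} → a ≢ b → side a ≢ side b → Adj G a b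
    opposite-adjacent {a} {b} a≢b a≁b = by-location (location a) (location b)
      where
      by-location : Location a → Location b → Adj G a b
      by-location (above r<a) (root refl)  = adjacent-> r<a
      by-location (above r<a) (below b<r)  = adjacent-> (transₚ P b<r r<a)
      by-location (root refl) (above r<b)  = adjacent-< r<b
      by-location (below a<r) (above r<b)  = adjacent-< (transₚ P a<r r<b)
      by-location (root refl) (root refl)  = ⊥-elim (a≢b refl)
      by-location (root refl) (below b<r)  = ⊥-elim (a≁b (trans side-root (sym (side-below b<r))))
      by-location (below a<r) (root refl)  = ⊥-elim (a≁b (trans (side-below a<r) (sym side-root)))
      by-location (below a<r) (below b<r)  = ⊥-elim (a≁b (trans (side-below a<r) (sym (side-below b<r))))
      by-location (above r<a) (above r<b)  = ⊥-elim (a≁b (trans (side-above r<a) (sym (side-above r<b))))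

    comparable⇒adjacent : ∀ {a b} → a ≢ b → Comparable a b → Adj G a b
    comparable⇒adjacent a≢b (inj₁ a≁b)       = opposite-adjacent a≢b a≁b
    comparable⇒adjacent a≢b (inj₂ (inj₁ a∈)) = ancestor-adjacent a≢b a∈
    comparable⇒adjacent a≢b (inj₂ (inj₂ b∈)) = Adj-sym G (ancestor-adjacent (≢-sym a≢b) b∈)

    <⇒comparable : ∀ {a b} → a ◁ b → Comparable a b
    <⇒comparable {a} {b} a<b = by-location (location a) (location b)
      where
      by-location : Location a → Location b → Comparable a b
      by-location (root refl) _           = inj₂ (inj₁ (here refl))
      by-location _           (root refl) = inj₂ (inj₂ (here refl))
      by-location (below a<r) (below b<r) = inj₂ (inj₂ (Below.root-path-through a<b b<r))
      by-location (above r<a) (above r<b) = inj₂ (inj₁ (Above.root-path-through a<b r<a))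
      by-location (below a<r) (above r<b) =
        inj₁ (λ a∼b → case trans (sym (side-below a<r)) (trans a∼b (side-above r<b)) of λ ())
      by-location (above r<a) (below b<r) = ⊥-elim (irreflₚ P (transₚ P (transₚ P r<a a<b) b<r))

  adjacent⇔comparable : ∀ {a b} → a ≢ b → Adj G a b ⇔ Comparable a b
  adjacent⇔comparable {a} {b} a≢b = mk⇔
    (λ adj → [ <⇒comparable , comparable-sym ∘ <⇒comparable ]′ (Equivalence.to (orientation a b) adj))
    (comparable⇒adjacent a≢b)

theorem9 : ∀ (n : ℕ) (G : Graph n) (k : ℕ) → DoubleArborescence G → CliqueNumber G k
             → MinRepLength G (2 * n ∸ k)
theorem9 n G k ((P , orientation , connected , acyclic) , r , universal) ((S , S-clique , ∣S∣≡k) , maximum) =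
  (word , (word-complete , represents) , trans length-word (cong (2 * n ∸_) ∣S∣≡k)) ,
  representant-length-≥ G k maximum
  where
  open Arborescence G P orientation connected acyclic r universal
  open MaximumChain S
    (λ a b a∈ b∈ a≢b → Equivalence.to (adjacent⇔comparable a≢b) (S-clique a b a∈ b∈ a≢b))
    (λ T T-chain → subst (∣ T ∣ ≤_) (sym ∣S∣≡k) (maximum T
      (λ a b a∈ b∈ a≢b → Equivalence.from (adjacent⇔comparable a≢b) (T-chain a b a∈ b∈ a≢b))))
  represents : ∀ a b → a ≢ b → Adj G a b ⇔ Alternate word a b
  represents a b a≢b = word-alternation a≢b ⇔-∘ adjacent⇔comparable a≢b
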